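{- Let $t\ge 3$, $k_1>k_2\geq k_3\ge\cdots\geq k_t\ge 2$ and $k_1+k_3\leq n<k_1+k_2$. Let $k_t+2\leq j\leq k_t+k_2-1$ and let $F_2,G_2,H_2\in\mathcal{F}_{2,3}$ with $F_2\setminus F_2^{\mathrm t}=[k_t,j]$, $G_2\setminus G_2^{\mathrm t}=[k_t,j-1]$ and $H_2\setminus H_2^{\mathrm t}=[k_t,j-2]$. If $g(G_2)\geq g(F_2)$, then $g(H_2)>g(G_2)$.
   Context: Lexicographic order: $A\prec B$ if $A\supseteq B$ or $\min(A\setminus B)<\min(B\setminus A)$. $\mathcal{L}(R,k)=\{F\in\binom{[n]}{k}:F\prec R\}$. For $F\subseteq[n]$, $\ell(F)=\max\{x:[n-x+1,n]\subseteq F\}$ if $n\in F$ and $0$ otherwise; $F^{\mathrm t}=[n-\ell(F)+1,n]$ (empty if $\ell(F)=0$). Partner: $H$ is the partner of nonempty $F$ if $F\cap H=\{q\}$ and $F\cup H=[q]$ for some $q$. $k$-partner of $F$ ($|F|=f$, $k\le n-f$), with $H$ the partner of $F$, $h=|H|$: $H$ if $k=h$; $H\cup\{n-k+h+1,\dots,n\}$ if $k>h$; the lexicographically last $k$-set $K\prec H$ if $k<h$. For $h_1\le h_2$: an $h_2$-set $H_2$ is the $h_2$-parity of an $h_1$-set $H_1$ if $H_1\setminus H_1^{\mathrm t}=H_2\setminus H_2^{\mathrm t}$ and $\ell(H_2)-\ell(H_1)=h_2-h_1$. $(A,B)$ is maximal if $\mathcal{L}(A,|A|)$, $\mathcal{L}(B,|B|)$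 are cross-intersecting and neither can be enlarged (keeping uniformity) while remaining cross-intersecting. $\mathcal{R}_2=\{R\in\binom{[n]}{k_2}:\{1,n-k_2+2,\dots,n\}\prec R\prec\{k_t,n-k_2+2,\dots,n\}\}$, $\mathcal{R}_3=\{R\in\binom{[n]}{k_3}:[k_t]\cup[n-k_3+k_t+1,n]\prec R\prec\{1,n-k_3+2,\dots,n\}\}$, $\mathcal{F}_{2,3}=\{R\in\mathcal{R}_2:\exists R'\in\mathcal{R}_3,\ (R,R')\text{ maximal}\}$. For a $k_2$-set $G_2$ with $k_1$-parity $G_1$ (members of $\mathcal{F}_{2,3}$ have one), with $T_i$ the $k_i$-partner of $G_2$ ($i\in[3,t]$): $g(G_2)=|\mathcal{L}(G_1,k_1)|+|\mathcal{L}(G_2,k_2)|+\sum_{i=3}^t|\mathcal{L}(T_i,k_i)|$. -}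

module Defs where

open import Data.Nat using (ℕ; zero; suc; _+_; _∸_; _≤_; _<_; _⊔_; _⊓_; _≡ᵇ_; _<ᵇ_)
open import Data.Bool using (Bool; true; false; not; if_then_else_; T)
open import Data.List using (List; []; _∷_; _++_; map; foldr; length; null; upTo)
open import Data.Bool.ListAction using (any; all)
open import Data.List.Membership.Propositional using (_∈_; _∉_)
open import Data.Product using (Σ; _×_)
open import Relation.Nullary using (¬_)
open import Relation.Binary.PropositionalEquality using (_≡_)

-- Finite sets of positive integers are represented by lists of ℕ.
-- All sets that are quantified over are drawn from explicit enumerations
-- (sublists of [1..n]), hence are duplicate-free; |F| = length F.

keep : {A : Set} → (A → Bool) → List A → List A
keep p []       = []
keep p (x ∷ xs) = if p x then x ∷ keep p xs else keep p xs

sumℕ : List ℕ → ℕ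
sumℕ = foldr _+_ 0

-- [a , b] = {a, a+1, ..., b}  (empty if a > b)
range : ℕ → ℕ → List ℕ
range a b = map (a +_) (upTo (suc b ∸ a))

elem : ℕ → List ℕ → Bool
elem x A = any (x ≡ᵇ_) A

_∖_ : List ℕ → List ℕ → List ℕ
A ∖ B = keep (λ x → not (elem x B)) A

_∩_ : List ℕ → List ℕ → List ℕ
A ∩ B = keep (λ x → elem x B) A

_∪_ : List ℕ → List ℕ → List ℕ
A ∪ B = A ++ B

subᵇ : List ℕ → List ℕ → Bool
subᵇ A B = all (λ x → elem x B) A

_≐_ : List ℕ → List ℕ → Set
A ≐ B = ∀ x → elem x A ≡ elem x B

Meets : List ℕ → List ℕ → Set
Meets X Y = Σ ℕ λ x → T (elem x X) × T (elem x Y)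

minL : List ℕ → ℕ
minL []       = 0
minL (x ∷ xs) = foldr _⊓_ x xs

maxL : List ℕ → ℕ
maxL = foldr _⊔_ 0

sublists : List ℕ → List (List ℕ)
sublists []       = [] ∷ []
sublists (x ∷ xs) = map (x ∷_) (sublists xs) ++ sublists xs

subsetsOf : ℕ → List (List ℕ)
subsetsOf n = sublists (range 1 n)

binom : ℕ → ℕ → List (List ℕ)
binom n k = keep (λ A → length A ≡ᵇ k) (subsetsOf n)

prec : List ℕ → List ℕ → Bool
prec A B =
  if null (B ∖ A) then true
  else (if null (A ∖ B) then false else (minL (A ∖ B) <ᵇ minL (B ∖ A)))

_≺_ : List ℕ → List ℕ → Set
A ≺ B = T (prec A B)

Lex : ℕ → List ℕ → ℕ → List (List ℕ)
Lex n R k = keep (λ F → prec F R) (binom n k)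

ell : ℕ → List ℕ → ℕ
ell n F =
  if elem n F
  then maxL (keep (λ x → subᵇ (range (n ∸ x + 1) n) F) (range 0 n))
  else 0

top : ℕ → List ℕ → List ℕ
top n F = range (n ∸ ell n F + 1) n

IsPartner : List ℕ → List ℕ → Set
IsPartner F H = Σ ℕ λ q → ((F ∩ H) ≐ (q ∷ [])) × ((F ∪ H) ≐ range 1 q)

IsKPartner : ℕ → ℕ → List ℕ → List ℕ → Set
IsKPartner n k F K =
  K ∈ binom n k ×
  Σ (List ℕ) λ H → H ∈ subsetsOf n × IsPartner F H ×
    ((k ≡ length H → K ≐ H) ×
     (length H < k → K ≐ (H ∪ range (n ∸ k + length H + 1) n)) ×
     (k < length H → K ≺ H × (∀ K′ → K′ ∈ binom n k → K′ ≺ H → K′ ≺ K)))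

-- H₂ is the |H₂|-parity of H₁  (used when |H₁| ≤ |H₂|):
-- H₁ ∖ H₁^t = H₂ ∖ H₂^t  and  ℓ(H₂) - ℓ(H₁) = |H₂| - |H₁|
IsParity : ℕ → List ℕ → List ℕ → Set
IsParity n H₁ H₂ =
  ((H₁ ∖ top n H₁) ≐ (H₂ ∖ top n H₂)) ×
  (ell n H₂ ≡ ell n H₁ + (length H₂ ∸ length H₁))

IsParityOf : ℕ → ℕ → List ℕ → List ℕ → Set
IsParityOf n k₁ G₂ G₁ = G₁ ∈ binom n k₁ × IsParity n G₂ G₁

CrossIntersecting : List (List ℕ) → List (List ℕ) → Set
CrossIntersecting 𝒜 ℬ = ∀ X Y → X ∈ 𝒜 → Y ∈ ℬ → Meets X Y

NotEnlargeable : ℕ → ℕ → List (List ℕ) → List (List ℕ) → Set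
NotEnlargeable n a 𝒜 ℬ =
  ¬ (Σ (List ℕ) λ X → X ∈ binom n a × X ∉ 𝒜 × (∀ Y → Y ∈ ℬ → Meets X Y))

Maximal : ℕ → List ℕ → List ℕ → Set
Maximal n A B =
  CrossIntersecting (Lex n A (length A)) (Lex n B (length B)) ×
  NotEnlargeable n (length A) (Lex n A (length A)) (Lex n B (length B)) ×
  NotEnlargeable n (length B) (Lex n B (length B)) (Lex n A (length A))

InR2 : ℕ → (ℕ → ℕ) → ℕ → List ℕ → Set
InR2 n k t R =
  R ∈ binom n (k 2) ×
  (1 ∷ range (n ∸ k 2 + 2) n) ≺ R ×
  R ≺ (k t ∷ range (n ∸ k 2 + 2) n)

InR3 : ℕ → (ℕ → ℕ) → ℕ → List ℕ → Set
InR3 n k t R =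
  R ∈ binom n (k 3) ×
  (range 1 (k t) ∪ range (n ∸ k 3 + k t + 1) n) ≺ R ×
  R ≺ (1 ∷ range (n ∸ k 3 + 2) n)

InF23 : ℕ → (ℕ → ℕ) → ℕ → List ℕ → Set
InF23 n k t R = InR2 n k t R × Σ (List ℕ) λ R′ → InR3 n k t R′ × Maximal n R R′

-- g(G₂) = |L(G₁,k₁)| + |L(G₂,k₂)| + Σ_{i=3}^t |L(T_i,k_i)|,
-- given the k₁-parity G₁ of G₂ and the k_i-partners T i of G₂.

gval : ℕ → (ℕ → ℕ) → ℕ → List ℕ → List ℕ → (ℕ → List ℕ) → ℕ
gval n k t G₁ G₂ T =
  length (Lex n G₁ (k 1)) + length (Lex n G₂ (k 2)) +
  sumℕ (map (λ i → length (Lex n (T i) (k i))) (range 3 t))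

-- A set X with X ∖ X^t = [k_t, J] is [k_t, J] ∪ [J + s + 1, n], and the number
-- of k-sets lexicographically before it, before its k₁-parity and before its
-- k_i-partners depends only on q = J - k_t + 1 and u = n - J: up to constants
-- these are C(u, k₂ - q), C(u, k₁ - q) and Σ_{x < q} C(u + x, k_i - k_t).
-- Lowering J by one moves one term of each sum into the binomial coefficients,
-- so g(G₂) ≥ g(F₂) says Σ_i C(u, k_i - k_t) ≤ C(u, L + 1) + C(u, l + 1), where
-- u, l, L are n - J, k₂ - q, k₁ - q for F₂. Multiplying by L + 2 and using
-- (u + 1) C(u, c) = (u + 1 - c) C(u + 1, c) turns this into the strict
-- inequality one level up, which is g(H₂) > g(G₂).

{-# OPTIONS --safe #-}
module Submission where

open import Defs
open import Data.Nat using (ℕ; suc; _+_; _∸_; _≤_; _<_; _≥_; _>_)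
open import Data.List using (List)

open import Data.Nat using (zero; _*_; _≡ᵇ_; _<ᵇ_; _⊓_; _⊔_; z≤n; s≤s; z<s; >-nonZero)
open import Data.Nat.Properties
open import Data.Nat.Tactic.RingSolver using (solve-∀)
open import Data.Bool using (Bool; true; false; not; if_then_else_; T; _∧_; _∨_)
open import Data.Bool.Properties using (¬-not; ∨-identityʳ; ∨-zeroʳ; ∧-identityʳ; ∧-zeroʳ; ∧-inverseʳ)
open import Data.List using ([]; _∷_; _++_; map; length; null; applyUpTo)
open import Data.List.Properties using (length-++; length-map; map-upTo)
open import Data.Bool.ListAction using (all)
open import Data.List.Membership.Propositional using (_∈_)
open import Data.List.Membership.Propositional.Properties using (∈-++⁻; ∈-map⁻)
open import Data.List.Relation.Unary.Any using (here; there)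
open import Data.Product using (Σ; _×_; _,_; proj₁; proj₂)
open import Data.Sum using (_⊎_; inj₁; inj₂; [_,_]′)
open import Data.Empty using (⊥-elim)
open import Data.Unit using (tt)
open import Function using (_∘_)
open import Relation.Nullary using (yes; no)
open import Relation.Binary.PropositionalEquality hiding (J)

true≢false : true ≢ false
true≢false ()

T⇒≡true : ∀ {b} → T b → b ≡ true
T⇒≡true {true} _ = refl

≡true⇒T : ∀ {b} → b ≡ true → T b
≡true⇒T refl = tt

≡ᵇ-true⇒≡ : ∀ x y → (x ≡ᵇ y) ≡ true → x ≡ y
≡ᵇ-true⇒≡ x y e = ≡ᵇ⇒≡ x y (≡true⇒T e)

≡ᵇ-refl : ∀ x → (x ≡ᵇ x) ≡ true
≡ᵇ-refl zero    = refl
≡ᵇ-refl (suc x) = ≡ᵇ-refl x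

≢⇒≡ᵇ-false : ∀ x y → x ≢ y → (x ≡ᵇ y) ≡ false
≢⇒≡ᵇ-false x y x≢y = ¬-not (x≢y ∘ ≡ᵇ-true⇒≡ x y)

≡ᵇ-false⇒≢ : ∀ x y → (x ≡ᵇ y) ≡ false → x ≢ y
≡ᵇ-false⇒≢ x .x e refl with () ← trans (sym (≡ᵇ-refl x)) e

<⇒<ᵇ-true : ∀ x y → x < y → (x <ᵇ y) ≡ true
<⇒<ᵇ-true x y x<y with x <ᵇ y | <⇒<ᵇ x<y
... | true | _ = refl

≤⇒<ᵇ-false : ∀ x y → y ≤ x → (x <ᵇ y) ≡ false
≤⇒<ᵇ-false x y y≤x = ¬-not λ e → <-irrefl refl (<-≤-trans (<ᵇ⇒< x y (≡true⇒T e)) y≤x)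

∨-trueˡ : ∀ {a} b → a ≡ true → (a ∨ b) ≡ true
∨-trueˡ b refl = refl

∨-trueʳ : ∀ a {b} → b ≡ true → (a ∨ b) ≡ true
∨-trueʳ true  refl = refl
∨-trueʳ false refl = refl

∨-true⁻ : ∀ a b → (a ∨ b) ≡ true → a ≡ true ⊎ b ≡ true
∨-true⁻ true  b e = inj₁ refl
∨-true⁻ false b e = inj₂ e

∧-true⁻ˡ : ∀ a b → (a ∧ b) ≡ true → a ≡ true
∧-true⁻ˡ true b e = refl

χ : List ℕ → ℕ → Bool
χ A x = elem x A

elem-keep : ∀ (p : ℕ → Bool) xs x → elem x (keep p xs) ≡ (elem x xs ∧ p x)
elem-keep p [] x = refl
elem-keep p (y ∷ ys) x with p y in py
... | true with x ≡ᵇ y in xy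
...   | true rewrite ≡ᵇ-true⇒≡ x y xy = sym py
...   | false = elem-keep p ys x
elem-keep p (y ∷ ys) x | false with x ≡ᵇ y in xy
...   | true rewrite ≡ᵇ-true⇒≡ x y xy =
  trans (elem-keep p ys y) (trans (cong (elem y ys ∧_) py) (trans (∧-zeroʳ _) (sym py)))
...   | false = elem-keep p ys x

elem-++ : ∀ xs ys x → elem x (xs ++ ys) ≡ (elem x xs ∨ elem x ys)
elem-++ [] ys x = refl
elem-++ (y ∷ xs) ys x with x ≡ᵇ y
... | true  = refl
... | false = elem-++ xs ys x

elem-∖ : ∀ A B x → elem x (A ∖ B) ≡ (elem x A ∧ not (elem x B))
elem-∖ A B = elem-keep (λ y → not (elem y B)) A

∈⇒elem : ∀ {x xs} → x ∈ xs → elem x xs ≡ true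
∈⇒elem {x} (here refl) rewrite ≡ᵇ-refl x = refl
∈⇒elem {x} {y ∷ ys} (there p) with x ≡ᵇ y
... | true  = refl
... | false = ∈⇒elem p

elem⇒∈ : ∀ x xs → elem x xs ≡ true → x ∈ xs
elem⇒∈ x (y ∷ ys) e with x ≡ᵇ y in xy
... | true  = here (≡ᵇ-true⇒≡ x y xy)
... | false = there (elem⇒∈ x ys e)

∈-keep⁻ : ∀ {A : Set} (p : A → Bool) xs {x} → x ∈ keep p xs → x ∈ xs × p x ≡ true
∈-keep⁻ p (y ∷ ys) m with p y in py
∈-keep⁻ p (y ∷ ys) (here refl) | true = here refl , py
∈-keep⁻ p (y ∷ ys) (there m)   | true = let (m′ , e) = ∈-keep⁻ p ys m in there m′ , e
∈-keep⁻ p (y ∷ ys) m           | false = let (m′ , e) = ∈-keep⁻ p ys m in there m′ , e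

keep-cong : ∀ {A : Set} (p q : A → Bool) xs → (∀ x → x ∈ xs → p x ≡ q x) → keep p xs ≡ keep q xs
keep-cong p q [] h = refl
keep-cong p q (x ∷ xs) h with p x in px | q x in qx
... | true  | true  = cong (x ∷_) (keep-cong p q xs (λ y → h y ∘ there))
... | false | false = keep-cong p q xs (λ y → h y ∘ there)
... | true  | false with () ← trans (sym px) (trans (h x (here refl)) qx)
... | false | true  with () ← trans (sym qx) (trans (sym (h x (here refl))) px)

keep-++ : ∀ {A : Set} (p : A → Bool) xs ys → keep p (xs ++ ys) ≡ keep p xs ++ keep p ys
keep-++ p [] ys = refl
keep-++ p (x ∷ xs) ys with p x
... | true  = cong (x ∷_) (keep-++ p xs ys)
... | false = keep-++ p xs ys

keep-map : ∀ {A B : Set} (p : B → Bool) (f : A → B) xs →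
           keep p (map f xs) ≡ map f (keep (p ∘ f) xs)
keep-map p f [] = refl
keep-map p f (x ∷ xs) with p (f x)
... | true  = cong (f x ∷_) (keep-map p f xs)
... | false = keep-map p f xs

keep-keep : ∀ {A : Set} (p q : A → Bool) xs → keep p (keep q xs) ≡ keep (λ x → q x ∧ p x) xs
keep-keep p q [] = refl
keep-keep p q (x ∷ xs) with q x
... | false = keep-keep p q xs
... | true with p x
...   | true  = cong (x ∷_) (keep-keep p q xs)
...   | false = keep-keep p q xs

keep-none : ∀ {A : Set} (p : A → Bool) xs → (∀ x → x ∈ xs → p x ≡ false) → keep p xs ≡ []
keep-none p [] h = refl
keep-none p (x ∷ xs) h with p x in px
... | true with () ← trans (sym px) (h x (here refl))
... | false = keep-none p xs (λ y → h y ∘ there)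

length-keep-++ : ∀ {A : Set} (p : A → Bool) xs ys →
                 length (keep p (xs ++ ys)) ≡ length (keep p xs) + length (keep p ys)
length-keep-++ p xs ys = trans (cong length (keep-++ p xs ys)) (length-++ (keep p xs))

length-keep-map : ∀ {A B : Set} (p : B → Bool) (f : A → B) xs →
                  length (keep p (map f xs)) ≡ length (keep (p ∘ f) xs)
length-keep-map p f xs = trans (cong length (keep-map p f xs)) (length-map f (keep (p ∘ f) xs))

length-keep-cong : ∀ {A : Set} (p q : A → Bool) xs → (∀ x → x ∈ xs → p x ≡ q x) →
                   length (keep p xs) ≡ length (keep q xs)
length-keep-cong p q xs h = cong length (keep-cong p q xs h)

length-keep-none : ∀ {A : Set} (p : A → Bool) xs → (∀ x → x ∈ xs → p x ≡ false) →
                   length (keep p xs) ≡ 0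
length-keep-none p xs h = cong length (keep-none p xs h)

-- [a, a + c): the form of range a b that structural recursion can use
span : ℕ → ℕ → List ℕ
span a zero    = []
span a (suc c) = a ∷ span (suc a) c

applyUpTo≡span : ∀ c (g : ℕ → ℕ) a → (∀ i → g i ≡ a + i) → applyUpTo g c ≡ span a c
applyUpTo≡span zero    g a h = refl
applyUpTo≡span (suc c) g a h = cong₂ _∷_ (trans (h 0) (+-identityʳ a))
  (applyUpTo≡span c (g ∘ suc) (suc a) (λ i → trans (h (suc i)) (+-suc a i)))

range≡span : ∀ a b → range a b ≡ span a (suc b ∸ a)
range≡span a b = trans (map-upTo (a +_) (suc b ∸ a)) (applyUpTo≡span (suc b ∸ a) (a +_) a (λ _ → refl))

length-span : ∀ a c → length (span a c) ≡ c
length-span a zero    = refl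
length-span a (suc c) = cong suc (length-span (suc a) c)

a<a+suc : ∀ a c → a < a + suc c
a<a+suc a c = subst (a <_) (sym (+-suc a c)) (s≤s (m≤m+n a c))

elem-span⁻ : ∀ a c x → elem x (span a c) ≡ true → a ≤ x × x < a + c
elem-span⁻ a (suc c) x e with x ≡ᵇ a in xa
... | true rewrite ≡ᵇ-true⇒≡ x a xa = ≤-refl , a<a+suc a c
... | false = let (a<x , x<) = elem-span⁻ (suc a) c x e in <⇒≤ a<x , subst (x <_) (sym (+-suc a c)) x<

elem-span⁺ : ∀ a c x → a ≤ x → x < a + c → elem x (span a c) ≡ true
elem-span⁺ a zero x a≤x x< = ⊥-elim (<-irrefl refl (≤-<-trans a≤x (subst (x <_) (+-identityʳ a) x<)))
elem-span⁺ a (suc c) x a≤x x< with x ≡ᵇ a in xa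
... | true  = refl
... | false = elem-span⁺ (suc a) c x (≤∧≢⇒< a≤x (≡ᵇ-false⇒≢ x a xa ∘ sym)) (subst (x <_) (+-suc a c) x<)

elem-range⁺ : ∀ a b x → a ≤ x → x ≤ b → elem x (range a b) ≡ true
elem-range⁺ a b x a≤x x≤b rewrite range≡span a b =
  elem-span⁺ a (suc b ∸ a) x a≤x (subst (x <_) (sym (m+[n∸m]≡n (≤-trans a≤x (m≤n⇒m≤1+n x≤b)))) (s≤s x≤b))

elem-range⁻ : ∀ a b x → elem x (range a b) ≡ true → a ≤ x × x ≤ b
elem-range⁻ a b x e rewrite range≡span a b with elem-span⁻ a (suc b ∸ a) x e | a ≤? suc b
... | a≤x , x< | yes a≤1+b = a≤x , ≤-pred (subst (x <_) (m+[n∸m]≡n a≤1+b) x<)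
... | a≤x , x< | no a≰1+b  = ⊥-elim (<-irrefl refl (≤-<-trans a≤x
      (subst (x <_) (trans (cong (a +_) (m≤n⇒m∸n≡0 (<⇒≤ (≰⇒> a≰1+b)))) (+-identityʳ a)) x<)))

elem-range-out : ∀ a b x → x < a ⊎ b < x → elem x (range a b) ≡ false
elem-range-out a b x out = ¬-not λ e → let (a≤x , x≤b) = elem-range⁻ a b x e in
  [ (λ x<a → <-irrefl refl (<-≤-trans x<a a≤x)) , (λ b<x → <-irrefl refl (<-≤-trans b<x x≤b)) ]′ out

range-above-empty : ∀ n a x → a ≡ suc n → elem x (range a n) ≡ false
range-above-empty n a x refl with x ≤? n
... | yes x≤n = elem-range-out (suc n) n x (inj₁ (s≤s x≤n))
... | no  x≰n = elem-range-out (suc n) n x (inj₂ (≰⇒> x≰n))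

-- Pascal's recursion rather than Data.Nat.Combinatorics._C_, so that the
-- counting arguments below reduce by computation.
binomial : ℕ → ℕ → ℕ
binomial n       zero    = 1
binomial zero    (suc k) = 0
binomial (suc n) (suc k) = binomial n k + binomial n (suc k)

binomial-n-large : ∀ n k → binomial n (suc (n + k)) ≡ 0
binomial-n-large zero    k = refl
binomial-n-large (suc n) k = cong₂ _+_ (binomial-n-large n k)
  (subst (λ z → binomial n z ≡ 0) (cong suc (+-suc n k)) (binomial-n-large n (suc k)))

binomial->⇒≡0 : ∀ {n k} → n < k → binomial n k ≡ 0
binomial->⇒≡0 {n} {k} n<k = subst (λ z → binomial n z ≡ 0) (m+[n∸m]≡n n<k) (binomial-n-large n (k ∸ suc n))

binomial-n-n : ∀ n → binomial n n ≡ 1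
binomial-n-n zero    = refl
binomial-n-n (suc n) = cong₂ _+_ (binomial-n-n n) (binomial->⇒≡0 (n<1+n n))

binomial-n-1 : ∀ n → binomial n 1 ≡ n
binomial-n-1 zero    = refl
binomial-n-1 (suc n) = cong suc (binomial-n-1 n)

binomial-pos : ∀ n k → k ≤ n → 0 < binomial n k
binomial-pos n       zero    _         = z<s
binomial-pos (suc n) (suc k) (s≤s k≤n) = ≤-trans (binomial-pos n k k≤n) (m≤m+n (binomial n k) _)

suc-*-binomial-suc : ∀ n k d → k + d ≡ n → suc k * binomial n (suc k) ≡ d * binomial n k
suc-*-binomial-suc zero    zero    zero    e  = refl
suc-*-binomial-suc (suc n) zero    .(suc n) refl =
  trans (+-identityʳ _) (trans (cong suc (binomial-n-1 n)) (sym (*-identityʳ (suc n))))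
suc-*-binomial-suc (suc n) (suc k) zero    e  =
  trans (cong (suc (suc k) *_) (cong₂ _+_ (binomial->⇒≡0 n<1+k) (binomial->⇒≡0 (m<n⇒m<1+n n<1+k))))
        (*-zeroʳ (suc (suc k)))
  where
  n<1+k : n < suc k
  n<1+k = s≤s (≤-reflexive (trans (sym (suc-injective e)) (+-identityʳ k)))
suc-*-binomial-suc (suc n) (suc k) (suc d) e =
  begin
    suc (suc k) * (binomial n (suc k) + binomial n (suc (suc k)))
  ≡⟨ *-distribˡ-+ (suc (suc k)) (binomial n (suc k)) _ ⟩
    suc (suc k) * binomial n (suc k) + suc (suc k) * binomial n (suc (suc k))
  ≡⟨ cong (suc (suc k) * binomial n (suc k) +_)
          (suc-*-binomial-suc n (suc k) d (trans (sym (+-suc k d)) (suc-injective e))) ⟩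
    suc (suc k) * binomial n (suc k) + d * binomial n (suc k)
  ≡⟨ shift (suc k) d (binomial n (suc k)) ⟩
    suc k * binomial n (suc k) + suc d * binomial n (suc k)
  ≡⟨ cong (_+ suc d * binomial n (suc k)) (suc-*-binomial-suc n k (suc d) (suc-injective e)) ⟩
    suc d * binomial n k + suc d * binomial n (suc k)
  ≡⟨ *-distribˡ-+ (suc d) (binomial n k) _ ⟨
    suc d * (binomial n k + binomial n (suc k))
  ∎
  where
  open ≡-Reasoning
  shift : ∀ k d b → suc k * b + d * b ≡ k * b + suc d * b
  shift = solve-∀

suc-*-binomial-suc-suc : ∀ n k → suc k * binomial (suc n) (suc k) ≡ suc n * binomial n k
suc-*-binomial-suc-suc n k with k ≤? n
... | yes k≤n =
  trans (*-distribˡ-+ (suc k) (binomial n k) _)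
  (trans (cong (suc k * binomial n k +_) (suc-*-binomial-suc n k (n ∸ k) (m+[n∸m]≡n k≤n)))
  (trans (sym (*-distribʳ-+ (binomial n k) (suc k) (n ∸ k)))
         (cong (λ z → suc z * binomial n k) (m+[n∸m]≡n k≤n))))
... | no k≰n =
  trans (cong (suc k *_) (cong₂ _+_ (binomial->⇒≡0 n<k) (binomial->⇒≡0 (m<n⇒m<1+n n<k))))
  (trans (*-zeroʳ (suc k)) (sym (trans (cong (suc n *_) (binomial->⇒≡0 n<k)) (*-zeroʳ (suc n)))))
  where
  n<k : n < k
  n<k = ≰⇒> k≰n

binomialSum : ℕ → ℕ → ℕ → ℕ
binomialSum zero    c k = 0
binomialSum (suc d) c k = binomial (d + c) k + binomialSum d c k

binomialSum-suc : ∀ d u c → binomialSum (suc d) u c ≡ binomial u c + binomialSum d (suc u) c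
binomialSum-suc zero    u c = refl
binomialSum-suc (suc d) u c =
  begin
    binomial (suc d + u) c + binomialSum (suc d) u c
  ≡⟨ cong₂ (λ z w → binomial z c + w) (sym (+-suc d u)) (binomialSum-suc d u c) ⟩
    binomial (d + suc u) c + (binomial u c + binomialSum d (suc u) c)
  ≡⟨ x+[y+z]≡y+[x+z] (binomial (d + suc u) c) (binomial u c) _ ⟩
    binomial u c + binomialSum (suc d) (suc u) c
  ∎
  where
  open ≡-Reasoning
  x+[y+z]≡y+[x+z] : ∀ x y z → x + (y + z) ≡ y + (x + z)
  x+[y+z]≡y+[x+z] = solve-∀

count-sublists-of-length : ∀ (xs : List ℕ) k →
  length (keep (λ F → length F ≡ᵇ k) (sublists xs)) ≡ binomial (length xs) k
count-sublists-of-length []       zero    = refl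
count-sublists-of-length []       (suc k) = refl
count-sublists-of-length (x ∷ xs) k =
  trans (length-keep-++ _ (map (x ∷_) (sublists xs)) (sublists xs))
  (trans (cong (_+ length (keep (λ F → length F ≡ᵇ k) (sublists xs)))
               (length-keep-map (λ F → length F ≡ᵇ k) (x ∷_) (sublists xs)))
  (split k))
  where
  split : ∀ k → length (keep (λ F → suc (length F) ≡ᵇ k) (sublists xs))
                + length (keep (λ F → length F ≡ᵇ k) (sublists xs)) ≡ binomial (suc (length xs)) k
  split zero    = trans (cong (_+ length (keep (λ F → length F ≡ᵇ 0) (sublists xs)))
                              (length-keep-none _ (sublists xs) (λ _ _ → refl)))
                        (count-sublists-of-length xs zero)
  split (suc k) = cong₂ _+_ (count-sublists-of-length xs k) (count-sublists-of-length xs (suc k))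

AgreeOn : (ℕ → Bool) → (ℕ → Bool) → ℕ → ℕ → Set
AgreeOn f g a c = ∀ x → a ≤ x → x < a + c → f x ≡ g x

agreeOn-head : ∀ {f g a c} → AgreeOn f g a (suc c) → f a ≡ g a
agreeOn-head {a = a} {c} h = h a ≤-refl (a<a+suc a c)

agreeOn-tail : ∀ {f g a c} → AgreeOn f g a (suc c) → AgreeOn f g (suc a) c
agreeOn-tail {a = a} {c} h x a<x x< = h x (<⇒≤ a<x) (subst (x <_) (sym (+-suc a c)) x<)

agreeOn-∷ : ∀ a c F → AgreeOn (χ (a ∷ F)) (χ F) (suc a) c
agreeOn-∷ a c F x a<x _ with x ≡ᵇ a in xa
... | true  = ⊥-elim (<-irrefl (sym (≡ᵇ-true⇒≡ x a xa)) a<x)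
... | false = refl

∈-sublists⇒⊆ : ∀ xs F x → F ∈ sublists xs → elem x F ≡ true → elem x xs ≡ true
∈-sublists⇒⊆ []       .[] x (here refl) ()
∈-sublists⇒⊆ (y ∷ ys) F   x m e with ∈-++⁻ (map (y ∷_) (sublists ys)) m
... | inj₂ m′ = ∨-trueʳ (x ≡ᵇ y) (∈-sublists⇒⊆ ys F x m′ e)
... | inj₁ m′ with ∈-map⁻ (y ∷_) m′
...   | F′ , m″ , refl with x ≡ᵇ y
...     | true  = refl
...     | false = ∈-sublists⇒⊆ ys F′ x m″ e

sublist-span-bounds : ∀ a c F → F ∈ sublists (span a c) → ∀ x → elem x F ≡ true → a ≤ x × x < a + c
sublist-span-bounds a c F m x e = elem-span⁻ a c x (∈-sublists⇒⊆ (span a c) F x m e)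

∉-sublist-span : ∀ a c F → F ∈ sublists (span (suc a) c) → χ F a ≡ false
∉-sublist-span a c F m = ¬-not λ e → <-irrefl refl (proj₁ (sublist-span-bounds (suc a) c F m a e))

countTrue : (ℕ → Bool) → ℕ → ℕ → ℕ
countTrue r a zero    = 0
countTrue r a (suc c) = (if r a then 1 else 0) + countTrue r (suc a) c

countTrue-cong : ∀ f g a c → AgreeOn f g a c → countTrue f a c ≡ countTrue g a c
countTrue-cong f g a zero    h = refl
countTrue-cong f g a (suc c) h rewrite agreeOn-head {f} {g} {a} {c} h =
  cong (_ +_) (countTrue-cong f g (suc a) c (agreeOn-tail {f} {g} {a} {c} h))

length-sublist-span : ∀ a c F → F ∈ sublists (span a c) → length F ≡ countTrue (χ F) a c
length-sublist-span a zero    .[] (here refl) = refl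
length-sublist-span a (suc c) F m with ∈-++⁻ (map (a ∷_) (sublists (span (suc a) c))) m
... | inj₂ m′ rewrite ∉-sublist-span a c F m′ = length-sublist-span (suc a) c F m′
... | inj₁ m′ with ∈-map⁻ (a ∷_) m′
...   | F′ , m″ , refl rewrite ≡ᵇ-refl a =
  cong suc (trans (length-sublist-span (suc a) c F′ m″)
                  (countTrue-cong _ _ (suc a) c (λ x a<x x< → sym (agreeOn-∷ a c F′ x a<x x<))))

precStep : Bool → Bool → Bool → Bool
precStep true  true  r = r
precStep false false r = r
precStep true  false r = true
precStep false true  r = false

precOn : (ℕ → Bool) → (ℕ → Bool) → ℕ → ℕ → Bool
precOn f g a zero    = true
precOn f g a (suc c) = precStep (f a) (g a) (precOn f g (suc a) c)

precOn-cong : ∀ f f′ g g′ a c → AgreeOn f f′ a c → AgreeOn g g′ a c → precOn f g a c ≡ precOn f′ g′ a c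
precOn-cong f f′ g g′ a zero    hf hg = refl
precOn-cong f f′ g g′ a (suc c) hf hg
  rewrite agreeOn-head {f} {f′} {a} {c} hf | agreeOn-head {g} {g′} {a} {c} hg =
  cong (precStep (f′ a) (g′ a))
       (precOn-cong f f′ g g′ (suc a) c (agreeOn-tail {f} {f′} {a} {c} hf) (agreeOn-tail {g} {g′} {a} {c} hg))

precOn-trans : ∀ f g h a c → precOn f g a c ≡ true → precOn g h a c ≡ true → precOn f h a c ≡ true
precOn-trans f g h a zero    _  _  = refl
precOn-trans f g h a (suc c) fg gh with f a | g a | h a
... | true  | true  | true  = precOn-trans f g h (suc a) c fg gh
... | true  | true  | false = refl
... | true  | false | false = refl
... | false | false | true  = gh
... | false | false | false = precOn-trans f g h (suc a) c fg gh
... | true  | false | true  with () ← gh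
... | false | true  | _     with () ← fg

minL-∈ : ∀ x xs → minL (x ∷ xs) ∈ (x ∷ xs)
minL-∈ x []       = here refl
minL-∈ x (z ∷ zs) with ⊓-sel z (minL (x ∷ zs))
... | inj₁ e rewrite e = there (here refl)
... | inj₂ e rewrite e with minL-∈ x zs
...   | here p  = here p
...   | there p = there (there p)

minL-≤ : ∀ x xs y → y ∈ (x ∷ xs) → minL (x ∷ xs) ≤ y
minL-≤ x []       y (here refl)         = ≤-refl
minL-≤ x (z ∷ zs) y (here refl)         = ≤-trans (m⊓n≤n z _) (minL-≤ x zs y (here refl))
minL-≤ x (z ∷ zs) y (there (here refl)) = m⊓n≤m z _
minL-≤ x (z ∷ zs) y (there (there p))   = ≤-trans (m⊓n≤n z _) (minL-≤ x zs y (there p))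

minL-≡ : ∀ L d → elem d L ≡ true → (∀ y → elem y L ≡ true → d ≤ y) → minL L ≡ d
minL-≡ (x ∷ xs) d e h = ≤-antisym (minL-≤ x xs d (elem⇒∈ d _ e)) (h _ (∈⇒elem (minL-∈ x xs)))

<-minL : ∀ L d → null L ≡ false → (∀ y → elem y L ≡ true → d < y) → d < minL L
<-minL (x ∷ xs) d _ h = h _ (∈⇒elem (minL-∈ x xs))

null-elem : ∀ L x → elem x L ≡ true → null L ≡ false
null-elem (y ∷ L) x _ = refl

null-none : ∀ L → (∀ x → elem x L ≡ false) → null L ≡ true
null-none []      h = refl
null-none (x ∷ L) h with () ← trans (sym (cong (_∨ elem x L) (≡ᵇ-refl x))) (h x)

agree⇒∉∖ : ∀ A B y → χ A y ≡ χ B y → elem y (A ∖ B) ≡ false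
agree⇒∉∖ A B y e = trans (elem-∖ A B y) (trans (cong (λ z → z ∧ not (χ B y)) e) (∧-inverseʳ (χ B y)))

AgreeBelow : List ℕ → List ℕ → ℕ → Set
AgreeBelow A B a = ∀ x → x < a → χ A x ≡ χ B x

firstDifference : ∀ A B a → AgreeBelow A B a → χ A a ≡ true → χ B a ≡ false →
  elem a (A ∖ B) ≡ true × (∀ y → elem y (A ∖ B) ≡ true → a ≤ y) × (∀ y → elem y (B ∖ A) ≡ true → a < y)
firstDifference A B a agree a∈A a∉B = a∈A∖B , least , below
  where
  a∈A∖B : elem a (A ∖ B) ≡ true
  a∈A∖B rewrite elem-∖ A B a | a∈A | a∉B = refl
  least : ∀ y → elem y (A ∖ B) ≡ true → a ≤ y
  least y e with y <? a
  ... | no y≮a = ≮⇒≥ y≮a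
  ... | yes y<a with () ← trans (sym e) (agree⇒∉∖ A B y (agree y y<a))
  below : ∀ y → elem y (B ∖ A) ≡ true → a < y
  below y e with y <? a
  ... | yes y<a with () ← trans (sym e) (agree⇒∉∖ B A y (sym (agree y y<a)))
  ... | no y≮a with m≤n⇒m<n∨m≡n (≮⇒≥ y≮a)
  ...   | inj₁ a<y  = a<y
  ...   | inj₂ refl with () ← trans (sym e) (trans (elem-∖ B A a) (cong (_∧ not (χ A a)) a∉B))

prec-firstInLeft : ∀ A B a → AgreeBelow A B a → χ A a ≡ true → χ B a ≡ false → prec A B ≡ true
prec-firstInLeft A B a agree a∈A a∉B with firstDifference A B a agree a∈A a∉B | null (B ∖ A) in nBA
... | _ , _ , _ | true = refl
... | a∈ , least , below | false rewrite null-elem (A ∖ B) a a∈ | minL-≡ (A ∖ B) a a∈ least =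
  <⇒<ᵇ-true a _ (<-minL (B ∖ A) a nBA below)

prec-firstInRight : ∀ A B a → AgreeBelow A B a → χ A a ≡ false → χ B a ≡ true → prec A B ≡ false
prec-firstInRight A B a agree a∉A a∈B with firstDifference B A a (λ x x<a → sym (agree x x<a)) a∈B a∉A
... | a∈ , least , below rewrite null-elem (B ∖ A) a a∈ with null (A ∖ B) in nAB
...   | true  = refl
...   | false rewrite minL-≡ (B ∖ A) a a∈ least = ≤⇒<ᵇ-false _ a (<⇒≤ (<-minL (A ∖ B) a nAB below))

Bounded : List ℕ → ℕ → Set
Bounded A n = ∀ x → elem x A ≡ true → 1 ≤ x × x ≤ n

agreeBelow-suc : ∀ {A B a} → AgreeBelow A B a → χ A a ≡ χ B a → AgreeBelow A B (suc a)
agreeBelow-suc agree e x x<1+a with m≤n⇒m<n∨m≡n (≤-pred x<1+a)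
... | inj₁ x<a  = agree x x<a
... | inj₂ refl = e

∖-empty-above : ∀ A B n → Bounded B n → AgreeBelow A B (suc n) → ∀ x → elem x (B ∖ A) ≡ false
∖-empty-above A B n bB agree x with x <? suc n
... | yes x≤n = agree⇒∉∖ B A x (sym (agree x x≤n))
... | no  x≰n = trans (elem-∖ B A x) (cong (_∧ not (χ A x)) (¬-not λ e → x≰n (s≤s (proj₂ (bB x e)))))

prec≡precOnFrom : ∀ A B n c a → a + c ≡ suc n → Bounded B n → AgreeBelow A B a →
                  prec A B ≡ precOn (χ A) (χ B) a c
prec≡precOnFrom A B n zero a a+0≡1+n bB agree
  rewrite null-none (B ∖ A)
            (∖-empty-above A B n bB (subst (AgreeBelow A B) (trans (sym (+-identityʳ a)) a+0≡1+n) agree)) = refl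
prec≡precOnFrom A B n (suc c) a eq bB agree with χ A a in ea | χ B a in eb
... | true  | true  = prec≡precOnFrom A B n c (suc a) (trans (sym (+-suc a c)) eq) bB
                        (agreeBelow-suc {A} {B} agree (trans ea (sym eb)))
... | false | false = prec≡precOnFrom A B n c (suc a) (trans (sym (+-suc a c)) eq) bB
                        (agreeBelow-suc {A} {B} agree (trans ea (sym eb)))
... | true  | false = prec-firstInLeft A B a agree ea eb
... | false | true  = prec-firstInRight A B a agree ea eb

prec≡precOn : ∀ A B n → Bounded A n → Bounded B n → prec A B ≡ precOn (χ A) (χ B) 1 n
prec≡precOn A B n bA bB = prec≡precOnFrom A B n n 1 refl bB nothingBelow1
  where
  nothingBelow1 : AgreeBelow A B 1
  nothingBelow1 (suc x) (s≤s ())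
  nothingBelow1 zero    _ = trans (¬-not λ e → <-irrefl refl (proj₁ (bA 0 e)))
                                  (sym (¬-not λ e → <-irrefl refl (proj₁ (bB 0 e))))

-- If a ∈ r, a k-set precedes r only if it contains a; if a ∉ r, every
-- k-set containing a precedes r.
precedingStep : Bool → ℕ → ℕ → (ℕ → ℕ) → ℕ
precedingStep true  c zero    f = 0
precedingStep true  c (suc k) f = f k
precedingStep false c zero    f = f zero
precedingStep false c (suc k) f = binomial c k + f (suc k)

countPreceding : (ℕ → Bool) → ℕ → ℕ → ℕ → ℕ
countPreceding r a zero    zero    = 1
countPreceding r a zero    (suc k) = 0
countPreceding r a (suc c) k       = precedingStep (r a) c k (countPreceding r (suc a) c)

countPreceding-cong : ∀ f g a c k → AgreeOn f g a c → countPreceding f a c k ≡ countPreceding g a c k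
countPreceding-cong f g a zero    zero    h = refl
countPreceding-cong f g a zero    (suc k) h = refl
countPreceding-cong f g a (suc c) k       h rewrite agreeOn-head {f} {g} {a} {c} h =
  precedingStep-cong (g a) k (λ k′ → countPreceding-cong f g (suc a) c k′ (agreeOn-tail {f} {g} {a} {c} h))
  where
  precedingStep-cong : ∀ b k {F G : ℕ → ℕ} → (∀ k′ → F k′ ≡ G k′) →
                       precedingStep b c k F ≡ precedingStep b c k G
  precedingStep-cong true  zero    h = refl
  precedingStep-cong true  (suc k) h = h k
  precedingStep-cong false zero    h = h zero
  precedingStep-cong false (suc k) h = cong (binomial c k +_) (h (suc k))

precedingStep-count : ∀ (S : List (List ℕ)) (Q : List ℕ → Bool) c (f : ℕ → ℕ) →
  (∀ k → length (keep (λ F → length F ≡ᵇ k) S) ≡ binomial c k) →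
  (∀ k → length (keep (λ F → (length F ≡ᵇ k) ∧ Q F) S) ≡ f k) →
  ∀ b k → length (keep (λ F → (suc (length F) ≡ᵇ k) ∧ precStep true b (Q F)) S)
          + length (keep (λ F → (length F ≡ᵇ k) ∧ precStep false b (Q F)) S)
          ≡ precedingStep b c k f
precedingStep-count S Q c f #S #Q true zero =
  cong₂ _+_ (length-keep-none _ S λ _ _ → refl) (length-keep-none _ S λ _ _ → ∧-zeroʳ _)
precedingStep-count S Q c f #S #Q true (suc k) =
  trans (cong₂ _+_ (#Q k) (length-keep-none _ S λ _ _ → ∧-zeroʳ _)) (+-identityʳ (f k))
precedingStep-count S Q c f #S #Q false zero =
  cong₂ _+_ (length-keep-none _ S λ _ _ → refl) (#Q zero)
precedingStep-count S Q c f #S #Q false (suc k) =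
  cong₂ _+_ (trans (length-keep-cong _ _ S λ _ _ → ∧-identityʳ _) (#S k)) (#Q (suc k))

length-keep-precOn : ∀ r c a k →
  length (keep (λ F → (length F ≡ᵇ k) ∧ precOn (χ F) r a c) (sublists (span a c))) ≡ countPreceding r a c k
length-keep-precOn r zero    a zero    = refl
length-keep-precOn r zero    a (suc k) = refl
length-keep-precOn r (suc c) a k =
  begin
    length (keep (P k) (map (a ∷_) S ++ S))
  ≡⟨ length-keep-++ (P k) (map (a ∷_) S) S ⟩
    length (keep (P k) (map (a ∷_) S)) + length (keep (P k) S)
  ≡⟨ cong₂ _+_ (trans (length-keep-map (P k) (a ∷_) S) (length-keep-cong _ _ S withHead))
               (length-keep-cong _ _ S withoutHead) ⟩
    length (keep (λ F → (suc (length F) ≡ᵇ k) ∧ precStep true (r a) (Q F)) S)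
    + length (keep (λ F → (length F ≡ᵇ k) ∧ precStep false (r a) (Q F)) S)
  ≡⟨ precedingStep-count S Q c (countPreceding r (suc a) c) #S (length-keep-precOn r c (suc a)) (r a) k ⟩
    precedingStep (r a) c k (countPreceding r (suc a) c)
  ∎
  where
  open ≡-Reasoning
  S : List (List ℕ)
  S = sublists (span (suc a) c)
  P : ℕ → List ℕ → Bool
  P k F = (length F ≡ᵇ k) ∧ precOn (χ F) r a (suc c)
  Q : List ℕ → Bool
  Q F = precOn (χ F) r (suc a) c
  #S : ∀ k → length (keep (λ F → length F ≡ᵇ k) S) ≡ binomial c k
  #S k = trans (count-sublists-of-length (span (suc a) c) k) (cong (λ z → binomial z k) (length-span (suc a) c))
  withHead : ∀ F → F ∈ S → P k (a ∷ F) ≡ ((suc (length F) ≡ᵇ k) ∧ precStep true (r a) (Q F))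
  withHead F _ rewrite ≡ᵇ-refl a =
    cong (λ z → (suc (length F) ≡ᵇ k) ∧ precStep true (r a) z)
         (precOn-cong _ _ r r (suc a) c (agreeOn-∷ a c F) (λ _ _ _ → refl))
  withoutHead : ∀ F → F ∈ S → P k F ≡ ((length F ≡ᵇ k) ∧ precStep false (r a) (Q F))
  withoutHead F m rewrite ∉-sublist-span a c F m = refl

∈binom⁻ : ∀ n k X → X ∈ binom n k → X ∈ sublists (span 1 n) × length X ≡ k
∈binom⁻ n k X m with ∈-keep⁻ (λ A → length A ≡ᵇ k) (subsetsOf n) m
... | m′ , e = subst (λ L → X ∈ sublists L) (range≡span 1 n) m′ , ≡ᵇ-true⇒≡ _ _ e

sublist-Bounded : ∀ n X → X ∈ sublists (span 1 n) → Bounded X n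
sublist-Bounded n X m x e = let (1≤x , x<1+n) = sublist-span-bounds 1 n X m x e in 1≤x , ≤-pred x<1+n

∈subsetsOf⇒Bounded : ∀ n X → X ∈ subsetsOf n → Bounded X n
∈subsetsOf⇒Bounded n X m = sublist-Bounded n X (subst (λ L → X ∈ sublists L) (range≡span 1 n) m)

∈binom⇒Bounded : ∀ n k X → X ∈ binom n k → Bounded X n
∈binom⇒Bounded n k X m = sublist-Bounded n X (proj₁ (∈binom⁻ n k X m))

length-Lex : ∀ n R k → Bounded R n → length (Lex n R k) ≡ countPreceding (χ R) 1 n k
length-Lex n R k bR =
  begin
    length (keep (λ F → prec F R) (keep (λ A → length A ≡ᵇ k) (subsetsOf n)))
  ≡⟨ cong length (keep-keep (λ F → prec F R) (λ A → length A ≡ᵇ k) (subsetsOf n)) ⟩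
    length (keep (λ F → (length F ≡ᵇ k) ∧ prec F R) (sublists (range 1 n)))
  ≡⟨ cong (λ L → length (keep (λ F → (length F ≡ᵇ k) ∧ prec F R) (sublists L))) (range≡span 1 n) ⟩
    length (keep (λ F → (length F ≡ᵇ k) ∧ prec F R) (sublists (span 1 n)))
  ≡⟨ length-keep-cong _ _ (sublists (span 1 n))
       (λ F m → cong ((length F ≡ᵇ k) ∧_) (prec≡precOn F R n (sublist-Bounded n F m) bR)) ⟩
    length (keep (λ F → (length F ≡ᵇ k) ∧ precOn (χ F) (χ R) 1 n) (sublists (span 1 n)))
  ≡⟨ length-keep-precOn (χ R) n 1 k ⟩
    countPreceding (χ R) 1 n k
  ∎
  where open ≡-Reasoning

bool-⇔⇒≡ : ∀ {a b} → (a ≡ true → b ≡ true) → (b ≡ true → a ≡ true) → a ≡ b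
bool-⇔⇒≡ {true}          f g = sym (f refl)
bool-⇔⇒≡ {false} {true}  f g = g refl
bool-⇔⇒≡ {false} {false} f g = refl

length-Lex-lastBefore : ∀ n k K H → K ∈ binom n k → H ∈ subsetsOf n → K ≺ H →
  (∀ K′ → K′ ∈ binom n k → K′ ≺ H → K′ ≺ K) → length (Lex n K k) ≡ length (Lex n H k)
length-Lex-lastBefore n k K H K∈ H∈ K≺H last = length-keep-cong _ _ (binom n k) λ K′ m →
  bool-⇔⇒≡ (λ K′≺K → trans (prec≡precOn K′ H n (bd K′ m) bH)
                       (precOn-trans (χ K′) (χ K) (χ H) 1 n
                         (trans (sym (prec≡precOn K′ K n (bd K′ m) bK)) K′≺K)
                         (trans (sym (prec≡precOn K H n bK bH)) (T⇒≡true K≺H))))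
           (λ K′≺H → T⇒≡true (last K′ m (≡true⇒T K′≺H)))
  where
  bd : ∀ X → X ∈ binom n k → Bounded X n
  bd = ∈binom⇒Bounded n k
  bK : Bounded K n
  bK = bd K K∈
  bH : Bounded H n
  bH = ∈subsetsOf⇒Bounded n H H∈

length-Lex-≐ : ∀ n k K R → K ∈ binom n k → (∀ x → χ K x ≡ χ R x) →
  length (Lex n K k) ≡ countPreceding (χ R) 1 n k
length-Lex-≐ n k K R K∈ h =
  trans (length-Lex n K k (∈binom⇒Bounded n k K K∈)) (countPreceding-cong _ _ 1 n k (λ x _ _ → h x))

ConstOn : (ℕ → Bool) → ℕ → ℕ → Bool → Set
ConstOn r a d b = ∀ i → i < d → r (a + i) ≡ b

constOn-head : ∀ {r a d b} → ConstOn r a (suc d) b → r a ≡ b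
constOn-head {r} {a} h = trans (cong r (sym (+-identityʳ a))) (h 0 z<s)

constOn-tail : ∀ {r a d b} → ConstOn r a (suc d) b → ConstOn r (suc a) d b
constOn-tail {r} {a} h i i<d = trans (cong r (sym (+-suc a i))) (h (suc i) (s≤s i<d))

constOn-≤ : ∀ {r a d d′ b} → d′ ≤ d → ConstOn r a d b → ConstOn r a d′ b
constOn-≤ d′≤d h i i<d′ = h i (<-≤-trans i<d′ d′≤d)

countTrue-trueBlock : ∀ r a d c → ConstOn r a d true → countTrue r a (d + c) ≡ d + countTrue r (a + d) c
countTrue-trueBlock r a zero    c h = cong (λ z → countTrue r z c) (sym (+-identityʳ a))
countTrue-trueBlock r a (suc d) c h rewrite constOn-head {r} {a} {d} h =
  cong suc (trans (countTrue-trueBlock r (suc a) d c (constOn-tail {r} {a} h))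
                  (cong (λ z → d + countTrue r z c) (sym (+-suc a d))))

countTrue-falseBlock : ∀ r a d c → ConstOn r a d false → countTrue r a (d + c) ≡ countTrue r (a + d) c
countTrue-falseBlock r a zero    c h = cong (λ z → countTrue r z c) (sym (+-identityʳ a))
countTrue-falseBlock r a (suc d) c h rewrite constOn-head {r} {a} {d} h =
  trans (countTrue-falseBlock r (suc a) d c (constOn-tail {r} {a} h))
        (cong (λ z → countTrue r z c) (sym (+-suc a d)))

countPreceding-trueBlock : ∀ r a d c k → ConstOn r a d true →
  countPreceding r a (d + c) (d + k) ≡ countPreceding r (a + d) c k
countPreceding-trueBlock r a zero    c k h = cong (λ z → countPreceding r z c k) (sym (+-identityʳ a))
countPreceding-trueBlock r a (suc d) c k h rewrite constOn-head {r} {a} {d} h =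
  trans (countPreceding-trueBlock r (suc a) d c k (constOn-tail {r} {a} h))
        (cong (λ z → countPreceding r z c k) (sym (+-suc a d)))

countPreceding-falseBlock : ∀ r a d c k → ConstOn r a d false →
  countPreceding r a (d + c) (suc k) ≡ binomialSum d c k + countPreceding r (a + d) c (suc k)
countPreceding-falseBlock r a zero    c k h = cong (λ z → countPreceding r z c (suc k)) (sym (+-identityʳ a))
countPreceding-falseBlock r a (suc d) c k h rewrite constOn-head {r} {a} {d} h =
  trans (cong (binomial (d + c) k +_)
          (trans (countPreceding-falseBlock r (suc a) d c k (constOn-tail {r} {a} h))
                 (cong (λ z → binomialSum d c k + countPreceding r z c (suc k)) (sym (+-suc a d)))))
        (sym (+-assoc (binomial (d + c) k) (binomialSum d c k) _))

-- r is the lexicographically last k-subset of the interval.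
countPreceding-falseTrue : ∀ r a d k → ConstOn r a d false → ConstOn r (a + d) k true →
  countPreceding r a (d + k) k ≡ binomial (d + k) k
countPreceding-falseTrue r a zero k _ htrue =
  trans (subst (λ z → countPreceding r a z z ≡ countPreceding r (a + k) 0 0) (+-identityʳ k)
               (countPreceding-trueBlock r a k 0 0 (subst (λ z → ConstOn r z k true) (+-identityʳ a) htrue)))
        (sym (binomial-n-n k))
countPreceding-falseTrue r a (suc d) k hfalse htrue rewrite constOn-head {r} {a} {d} hfalse =
  step k (countPreceding-falseTrue r (suc a) d k (constOn-tail {r} {a} hfalse)
                                   (subst (λ z → ConstOn r z k true) (+-suc a d) htrue))
  where
  step : ∀ k → countPreceding r (suc a) (d + k) k ≡ binomial (d + k) k →
         precedingStep false (d + k) k (countPreceding r (suc a) (d + k)) ≡ binomial (suc (d + k)) k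
  step zero    e = e
  step (suc k) e = cong (binomial (d + suc k) k +_) e

countPreceding-zero : ∀ r a c x → a ≤ x → x < a + c → r x ≡ true → countPreceding r a c 0 ≡ 0
countPreceding-zero r a zero    x a≤x x< _ = ⊥-elim (<-irrefl refl (≤-<-trans a≤x (subst (x <_) (+-identityʳ a) x<)))
countPreceding-zero r a (suc c) x a≤x x< rx with r a in ra
... | true  = refl
... | false = countPreceding-zero r (suc a) c x
                (≤∧≢⇒< a≤x (λ { refl → true≢false (trans (sym rx) ra) }))
                (subst (x <_) (+-suc a c) x<) rx

maxL-∈ : ∀ L → maxL L ≡ 0 ⊎ maxL L ∈ L
maxL-∈ []      = inj₁ refl
maxL-∈ (x ∷ L) with ⊔-sel x (maxL L)
... | inj₁ e = inj₂ (subst (_∈ (x ∷ L)) (sym e) (here refl))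
... | inj₂ e with maxL-∈ L
...   | inj₁ z = inj₁ (trans e z)
...   | inj₂ m = inj₂ (subst (_∈ (x ∷ L)) (sym e) (there m))

all-elem⁻ : ∀ F xs x → all (λ y → elem y F) xs ≡ true → elem x xs ≡ true → elem x F ≡ true
all-elem⁻ F (y ∷ ys) x h e with elem y F in ey | x ≡ᵇ y in xy
... | true  | true rewrite ≡ᵇ-true⇒≡ x y xy = ey
... | true  | false = all-elem⁻ F ys x h e

tailInside : ℕ → List ℕ → ℕ → Bool
tailInside n F x = subᵇ (range (n ∸ x + 1) n) F

ell-≡0⊎∈ : ∀ n F → ell n F ≡ 0 ⊎ ell n F ∈ keep (tailInside n F) (range 0 n)
ell-≡0⊎∈ n F with elem n F
... | false = inj₁ refl
... | true  = maxL-∈ (keep (tailInside n F) (range 0 n))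

top-⊆ : ∀ n F x → elem x (top n F) ≡ true → elem x F ≡ true
top-⊆ n F x e with ell-≡0⊎∈ n F
... | inj₂ m = all-elem⁻ F (range (n ∸ ell n F + 1) n) x (proj₂ (∈-keep⁻ (tailInside n F) (range 0 n) m)) e
... | inj₁ ℓ≡0 with () ← trans (sym e)
      (range-above-empty n (n ∸ ell n F + 1) x (trans (cong (λ ℓ → n ∸ ℓ + 1) ℓ≡0) (+-comm n 1)))

TwoBlocks : ℕ → ℕ → ℕ → ℕ → List ℕ → Set
TwoBlocks n m J s X = ∀ x → χ X x ≡ (elem x (range (suc m) J) ∨ elem x (range (suc (J + s)) n))

χ-∖-≐ : ∀ X T R → (∀ x → elem x T ≡ true → elem x X ≡ true) → (X ∖ T) ≐ R →
        ∀ x → χ X x ≡ (elem x R ∨ elem x T)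
χ-∖-≐ X T R T⊆X X∖T≐R x with elem x T in x∈T
... | true  = trans (T⊆X x x∈T) (sym (∨-zeroʳ _))
... | false = trans (sym (∧-identityʳ (χ X x)))
              (trans (cong (λ b → χ X x ∧ not b) (sym x∈T))
              (trans (sym (elem-∖ X T x)) (trans (X∖T≐R x) (sym (∨-identityʳ _)))))

∖top≐range⇒TwoBlocks : ∀ n m J X → Bounded X n → suc m ≤ J → (X ∖ top n X) ≐ range (suc m) J →
  Σ ℕ λ s → J + s ≤ n × TwoBlocks n m J s X
∖top≐range⇒TwoBlocks n m J X bX m<J X∖top≐ = s , J+s≤n , twoBlocks
  where
  e : ℕ
  e = ell n X
  χX : ∀ x → χ X x ≡ (elem x (range (suc m) J) ∨ elem x (top n X))
  χX = χ-∖-≐ X (top n X) (range (suc m) J) (top-⊆ n X) X∖top≐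
  J∈range : elem J (range (suc m) J) ≡ true
  J∈range = elem-range⁺ (suc m) J J m<J ≤-refl
  J≤n : J ≤ n
  J≤n = proj₂ (bX J (trans (χX J) (∨-trueˡ _ J∈range)))
  J∉top : elem J (top n X) ≡ false
  J∉top = ¬-not λ J∈top → true≢false (trans (sym J∈range) (trans (sym (X∖top≐ J))
            (trans (elem-∖ X (top n X) J) (trans (cong (λ b → χ X J ∧ not b) J∈top) (∧-zeroʳ _)))))
  J≤n∸e : J ≤ n ∸ e
  J≤n∸e with n ∸ e + 1 ≤? J
  ... | yes top≤J with () ← trans (sym (elem-range⁺ _ n J top≤J J≤n)) J∉top
  ... | no  top≰J = ≤-pred (subst (J <_) (+-comm (n ∸ e) 1) (≰⇒> top≰J))
  s : ℕ
  s = n ∸ e ∸ J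
  J+s≡n∸e : J + s ≡ n ∸ e
  J+s≡n∸e = m+[n∸m]≡n J≤n∸e
  J+s≤n : J + s ≤ n
  J+s≤n = subst (_≤ n) (sym J+s≡n∸e) (m∸n≤m n e)
  twoBlocks : TwoBlocks n m J s X
  twoBlocks x = trans (χX x) (cong (λ a → elem x (range (suc m) J) ∨ elem x (range a n))
                                   (trans (+-comm (n ∸ e) 1) (cong suc (sym J+s≡n∸e))))

module _ (m q s e : ℕ) (X : List ℕ) (blocks : TwoBlocks (m + q + (s + e)) m (m + q) s X) where

  private
    J : ℕ
    J = m + q
    n : ℕ
    n = m + q + (s + e)
    n≡ : n ≡ m + (q + (s + e))
    n≡ = +-assoc m q (s + e)

  twoBlocks-block₁ : ConstOn (χ X) 1 m false
  twoBlocks-block₁ i i<m rewrite blocks (suc i)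
    | elem-range-out (suc m) J (suc i) (inj₁ (s≤s i<m))
    | elem-range-out (suc (J + s)) n (suc i) (inj₁ (s≤s (≤-trans i<m (≤-trans (m≤m+n m q) (m≤m+n J s))))) = refl

  twoBlocks-block₂ : ConstOn (χ X) (suc m) q true
  twoBlocks-block₂ i i<q rewrite blocks (suc m + i) =
    ∨-trueˡ _ (elem-range⁺ (suc m) J (suc m + i) (s≤s (m≤m+n m i)) (+-monoʳ-< m i<q))

  twoBlocks-block₃ : ConstOn (χ X) (suc m + q) s false
  twoBlocks-block₃ i i<s rewrite blocks (suc m + q + i)
    | elem-range-out (suc m) J (suc m + q + i) (inj₂ (s≤s (m≤m+n J i)))
    | elem-range-out (suc (J + s)) n (suc m + q + i) (inj₁ (s≤s (+-monoʳ-< J i<s))) = refl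

  twoBlocks-block₄ : ConstOn (χ X) (suc m + q + s) e true
  twoBlocks-block₄ i i<e rewrite blocks (suc m + q + s + i) =
    ∨-trueʳ _ (elem-range⁺ (suc (J + s)) n (suc m + q + s + i) (s≤s (m≤m+n (J + s) i))
                 (subst (suc (J + s + i) ≤_) (+-assoc J s e) (+-monoʳ-< (J + s) i<e)))

  length-TwoBlocks : X ∈ sublists (span 1 n) → length X ≡ q + e
  length-TwoBlocks X∈ =
    begin
      length X
    ≡⟨ length-sublist-span 1 n X X∈ ⟩
      countTrue (χ X) 1 n
    ≡⟨ cong (countTrue (χ X) 1) n≡ ⟩
      countTrue (χ X) 1 (m + (q + (s + e)))
    ≡⟨ countTrue-falseBlock (χ X) 1 m _ twoBlocks-block₁ ⟩
      countTrue (χ X) (suc m) (q + (s + e))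
    ≡⟨ countTrue-trueBlock (χ X) (suc m) q _ twoBlocks-block₂ ⟩
      q + countTrue (χ X) (suc m + q) (s + e)
    ≡⟨ cong (q +_) (countTrue-falseBlock (χ X) (suc m + q) s e twoBlocks-block₃) ⟩
      q + countTrue (χ X) (suc m + q + s) e
    ≡⟨ cong (q +_) (trans (cong (countTrue (χ X) (suc m + q + s)) (sym (+-identityʳ e)))
                          (countTrue-trueBlock (χ X) (suc m + q + s) e 0 twoBlocks-block₄)) ⟩
      q + (e + 0)
    ≡⟨ cong (q +_) (+-identityʳ e) ⟩
      q + e
    ∎
    where open ≡-Reasoning

  -- A k-set precedes X iff it contains a point of [1, m] or it contains
  -- [m + 1, J] and its other e points lie beyond J.
  twoBlocks-Bounded : Bounded X n
  twoBlocks-Bounded x x∈X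
    with ∨-true⁻ (elem x (range (suc m) J)) (elem x (range (suc (J + s)) n)) (trans (sym (blocks x)) x∈X)
  ... | inj₁ x∈low  = let (m<x , x≤J) = elem-range⁻ (suc m) J x x∈low in
                      ≤-trans (s≤s z≤n) m<x , ≤-trans x≤J (m≤m+n J (s + e))
  ... | inj₂ x∈high = let (J+s<x , x≤n) = elem-range⁻ (suc (J + s)) n x x∈high in ≤-trans (s≤s z≤n) J+s<x , x≤n

  length-Lex-TwoBlocks : ∀ q′ → q ≡ suc q′ →
    length (Lex n X (q + e)) ≡ binomialSum m (q + (s + e)) (q′ + e) + binomial (s + e) e
  length-Lex-TwoBlocks q′ refl =
    begin
      length (Lex n X (q + e))
    ≡⟨ length-Lex n X (q + e) twoBlocks-Bounded ⟩
      countPreceding (χ X) 1 n (suc q′ + e)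
    ≡⟨ cong (λ z → countPreceding (χ X) 1 z (q + e)) n≡ ⟩
      countPreceding (χ X) 1 (m + (q + (s + e))) (suc (q′ + e))
    ≡⟨ countPreceding-falseBlock (χ X) 1 m _ _ twoBlocks-block₁ ⟩
      binomialSum m (q + (s + e)) (q′ + e) + countPreceding (χ X) (suc m) (q + (s + e)) (q + e)
    ≡⟨ cong (binomialSum m (q + (s + e)) (q′ + e) +_)
            (countPreceding-trueBlock (χ X) (suc m) q (s + e) e twoBlocks-block₂) ⟩
      binomialSum m (q + (s + e)) (q′ + e) + countPreceding (χ X) (suc m + q) (s + e) e
    ≡⟨ cong (binomialSum m (q + (s + e)) (q′ + e) +_)
            (countPreceding-falseTrue (χ X) (suc m + q) s e twoBlocks-block₃ twoBlocks-block₄) ⟩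
      binomialSum m (q + (s + e)) (q′ + e) + binomial (s + e) e
    ∎
    where open ≡-Reasoning

-- H is the partner of F and p = max F, so that H = ([1, p] ∖ F) ∪ {p}.
PartnerAt : List ℕ → List ℕ → ℕ → Set
PartnerAt F H p = ∀ x → χ H x ≡ (if χ F x then x ≡ᵇ p else elem x (range 1 p))

isPartner⇒PartnerAt : ∀ F H p → IsPartner F H → χ F p ≡ true → (∀ y → χ F y ≡ true → y ≤ p) →
                      PartnerAt F H p
isPartner⇒PartnerAt F H p (q , F∩H≐q , F∪H≐[1,q]) p∈F p-max = subst (PartnerAt F H) q≡p partnerAt-q
  where
  ∩≡ : ∀ x → (χ F x ∧ χ H x) ≡ ((x ≡ᵇ q) ∨ false)
  ∩≡ x = trans (sym (elem-keep (λ y → elem y H) F x)) (F∩H≐q x)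
  ∪≡ : ∀ x → (χ F x ∨ χ H x) ≡ elem x (range 1 q)
  ∪≡ x = trans (sym (elem-++ F H x)) (F∪H≐[1,q] x)
  q≡p : q ≡ p
  q≡p = ≤-antisym (p-max q (∧-true⁻ˡ _ _ (trans (∩≡ q) (cong (_∨ false) (≡ᵇ-refl q)))))
                  (proj₂ (elem-range⁻ 1 q p (trans (sym (∪≡ p)) (∨-trueˡ _ p∈F))))
  partnerAt-q : PartnerAt F H q
  partnerAt-q x with χ F x in x∈F
  ... | true  = trans (cong (_∧ χ H x) (sym x∈F)) (trans (∩≡ x) (∨-identityʳ _))
  ... | false = trans (cong (_∨ χ H x) (sym x∈F)) (∪≡ x)

module _ (F H : List ℕ) (p : ℕ) (partner : PartnerAt F H p) where

  partnerAt-apex : χ F p ≡ true → χ H p ≡ true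
  partnerAt-apex p∈F rewrite partner p | p∈F = ≡ᵇ-refl p

  partnerAt-inF : ∀ a d → ConstOn (χ F) a d true → a + d ≤ p → ConstOn (χ H) a d false
  partnerAt-inF a d in-F a+d≤p i i<d rewrite partner (a + i) | in-F i i<d =
    ≢⇒≡ᵇ-false (a + i) p λ { refl → <-irrefl refl (<-≤-trans (+-monoʳ-< a i<d) a+d≤p) }

  partnerAt-outF : ∀ a d → ConstOn (χ F) a d false → 1 ≤ a → a + d ≤ suc p → ConstOn (χ H) a d true
  partnerAt-outF a d out-F 1≤a a+d≤1+p i i<d rewrite partner (a + i) | out-F i i<d =
    elem-range⁺ 1 p (a + i) (≤-trans 1≤a (m≤m+n a i)) (≤-pred (<-≤-trans (+-monoʳ-< a i<d) a+d≤1+p))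

  partnerAt-above : ∀ a d → p < a → ConstOn (χ H) a d false
  partnerAt-above a d p<a i _ rewrite partner (a + i) with χ F (a + i)
  ... | true  = ≢⇒≡ᵇ-false (a + i) p λ a+i≡p → <-irrefl refl (<-≤-trans p<a (subst (a ≤_) a+i≡p (m≤m+n a i)))
  ... | false = elem-range-out 1 p (a + i) (inj₂ (≤-trans p<a (m≤m+n a i)))

KPartnerCount : ℕ → ℕ → ℕ → ℕ → ℕ → List ℕ → List ℕ → Set
KPartnerCount m q s e c X K =
  TwoBlocks (m + q + (s + e)) m (m + q) s X → IsKPartner (m + q + (s + e)) (m + suc c) X K →
  length (Lex (m + q + (s + e)) K (m + suc c)) ≡ binomialSum q (s + e) c

record PartnerWithTop (m q s e′ : ℕ) (H : List ℕ) : Set where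
  field
    block₁ : ConstOn (χ H) 1 m true
    block₂ : ConstOn (χ H) (suc m) q false
    block₃ : ConstOn (χ H) (suc m + q) s true
    block₄ : ConstOn (χ H) (suc m + q + s) e′ false
    n∈H    : χ H (m + q + (s + suc e′)) ≡ true

partnerWithTop : ∀ m q s e′ X H → TwoBlocks (m + q + (s + suc e′)) m (m + q) s X → IsPartner X H →
                 PartnerWithTop m q s e′ H
partnerWithTop m q s e′ X H blocks partner = record
  { block₁ = partnerAt-outF X H n at 1 m (twoBlocks-block₁ m q s (suc e′) X blocks) ≤-refl
               (s≤s (≤-trans (m≤m+n m q) (m≤m+n (m + q) _)))
  ; block₂ = partnerAt-inF X H n at (suc m) q (twoBlocks-block₂ m q s (suc e′) X blocks)
               (subst (suc m + q ≤_) n≡ (s≤s (≤-trans (m≤m+n (m + q) s) (m≤m+n _ e′))))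
  ; block₃ = partnerAt-outF X H n at (suc m + q) s (twoBlocks-block₃ m q s (suc e′) X blocks) (s≤s z≤n)
               (s≤s (≤-trans (m≤m+n (m + q + s) (suc e′)) (≤-reflexive (+-assoc (m + q) s (suc e′)))))
  ; block₄ = partnerAt-inF X H n at (suc m + q + s) e′ (constOn-≤ {χ X} {suc m + q + s} (n≤1+n e′) X₄)
               (≤-reflexive n≡)
  ; n∈H    = partnerAt-apex X H n at n∈X
  }
  where
  n : ℕ
  n = m + q + (s + suc e′)
  n≡ : suc m + q + s + e′ ≡ n
  n≡ = arith m q s e′
    where
    arith : ∀ m q s e′ → suc m + q + s + e′ ≡ m + q + (s + suc e′)
    arith = solve-∀
  X₄ : ConstOn (χ X) (suc m + q + s) (suc e′) true
  X₄ = twoBlocks-block₄ m q s (suc e′) X blocks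
  n∈X : χ X n ≡ true
  n∈X = subst (λ x → χ X x ≡ true) n≡ (X₄ e′ (n<1+n e′))
  at : PartnerAt X H n
  at = isPartner⇒PartnerAt X H n partner n∈X (λ y → proj₂ ∘ twoBlocks-Bounded m q s (suc e′) X blocks y)

length-PartnerWithTop : ∀ m q s e′ H → PartnerWithTop m q s e′ H → H ∈ subsetsOf (m + q + (s + suc e′)) →
                        length H ≡ m + (s + 1)
length-PartnerWithTop m q s e′ H P H∈ =
  begin
    length H
  ≡⟨ length-sublist-span 1 n H (subst (λ L → H ∈ sublists L) (range≡span 1 n) H∈) ⟩
    countTrue (χ H) 1 n
  ≡⟨ cong (countTrue (χ H) 1) (n≡ m q s e′) ⟩
    countTrue (χ H) 1 (m + (q + (s + (e′ + 1))))
  ≡⟨ countTrue-trueBlock (χ H) 1 m _ block₁ ⟩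
    m + countTrue (χ H) (suc m) (q + (s + (e′ + 1)))
  ≡⟨ cong (m +_) (countTrue-falseBlock (χ H) (suc m) q _ block₂) ⟩
    m + countTrue (χ H) (suc m + q) (s + (e′ + 1))
  ≡⟨ cong (m +_) (countTrue-trueBlock (χ H) (suc m + q) s _ block₃) ⟩
    m + (s + countTrue (χ H) (suc m + q + s) (e′ + 1))
  ≡⟨ cong (λ z → m + (s + z)) (countTrue-falseBlock (χ H) (suc m + q + s) e′ 1 block₄) ⟩
    m + (s + ((if χ H (suc m + q + s + e′) then 1 else 0) + 0))
  ≡⟨ cong (λ z → m + (s + ((if χ H z then 1 else 0) + 0))) (last≡n m q s e′) ⟩
    m + (s + ((if χ H n then 1 else 0) + 0))
  ≡⟨ cong (λ b → m + (s + ((if b then 1 else 0) + 0))) n∈H ⟩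
    m + (s + 1)
  ∎
  where
  open ≡-Reasoning
  open PartnerWithTop P
  n : ℕ
  n = m + q + (s + suc e′)
  n≡ : ∀ m q s e′ → m + q + (s + suc e′) ≡ m + (q + (s + (e′ + 1)))
  n≡ = solve-∀
  last≡n : ∀ m q s e′ → suc m + q + s + e′ ≡ m + q + (s + suc e′)
  last≡n = solve-∀

countPreceding-PartnerWithTop : ∀ m q c s′ e′ H → PartnerWithTop m q (suc c + s′) e′ H →
  countPreceding (χ H) 1 (m + q + ((suc c + s′) + suc e′)) (m + suc c) ≡ binomialSum q ((suc c + s′) + suc e′) c
countPreceding-PartnerWithTop m q c s′ e′ H P =
  begin
    countPreceding (χ H) 1 (m + q + (s + suc e′)) (m + suc c)
  ≡⟨ cong (λ z → countPreceding (χ H) 1 z (m + suc c)) (+-assoc m q _) ⟩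
    countPreceding (χ H) 1 (m + (q + (s + suc e′))) (m + suc c)
  ≡⟨ countPreceding-trueBlock (χ H) 1 m _ (suc c) block₁ ⟩
    countPreceding (χ H) (suc m) (q + (s + suc e′)) (suc c)
  ≡⟨ countPreceding-falseBlock (χ H) (suc m) q (s + suc e′) c block₂ ⟩
    binomialSum q (s + suc e′) c + countPreceding (χ H) (suc m + q) (s + suc e′) (suc c)
  ≡⟨ cong (binomialSum q (s + suc e′) c +_) nothingAfterBlock₂ ⟩
    binomialSum q (s + suc e′) c + 0
  ≡⟨ +-identityʳ _ ⟩
    binomialSum q (s + suc e′) c
  ∎
  where
  open ≡-Reasoning
  open PartnerWithTop P
  s : ℕ
  s = suc c + s′
  gapStart≡n : ∀ m q c s′ e′ → suc m + q + suc c + (s′ + e′) ≡ m + q + ((suc c + s′) + suc e′)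
  gapStart≡n = solve-∀
  gapEnd≡1+n : ∀ m q c s′ e′ → suc m + q + suc c + (s′ + suc e′) ≡ suc (m + q + ((suc c + s′) + suc e′))
  gapEnd≡1+n = solve-∀
  nothingAfterBlock₂ : countPreceding (χ H) (suc m + q) (s + suc e′) (suc c) ≡ 0
  nothingAfterBlock₂ =
    trans (cong₂ (countPreceding (χ H) (suc m + q)) (+-assoc (suc c) s′ (suc e′)) (sym (+-identityʳ (suc c))))
    (trans (countPreceding-trueBlock (χ H) (suc m + q) (suc c) (s′ + suc e′) 0
              (constOn-≤ {χ H} {suc m + q} (m≤m+n (suc c) s′) block₃))
           (countPreceding-zero (χ H) (suc m + q + suc c) (s′ + suc e′) _
             (subst (suc m + q + suc c ≤_) (gapStart≡n m q c s′ e′) (m≤m+n _ (s′ + e′)))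
             (≤-reflexive (sym (gapEnd≡1+n m q c s′ e′))) n∈H))

-- When n ∈ X the partner H has more than k points, so the k-partner is the
-- last k-set before H and L(K, k) = L(H, k).
length-Lex-kPartner-withTop : ∀ m q c s′ e′ X K → KPartnerCount m q (suc c + s′) (suc e′) c X K
length-Lex-kPartner-withTop m q c s′ e′ X K blocks (K∈ , H , H∈ , partner , _ , _ , longerH) =
  trans (length-Lex-lastBefore n k K H K∈ H∈ (proj₁ (longerH k<|H|)) (proj₂ (longerH k<|H|)))
  (trans (length-Lex n H k (∈subsetsOf⇒Bounded n H H∈)) (countPreceding-PartnerWithTop m q c s′ e′ H P))
  where
  n k : ℕ
  n = m + q + ((suc c + s′) + suc e′)
  k = m + suc c
  P : PartnerWithTop m q (suc c + s′) e′ H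
  P = partnerWithTop m q (suc c + s′) e′ X H blocks partner
  k<|H| : k < length H
  k<|H| = subst (k <_) (sym (length-PartnerWithTop m q (suc c + s′) e′ H P H∈))
            (+-monoʳ-< m (subst (suc c <_) (+-comm 1 (suc c + s′)) (s≤s (s≤s (m≤m+n c s′)))))

-- For |H| = k the added interval is empty, so both clauses for |H| ≤ k say
-- K = H ∪ [n - k + |H| + 1, n].
kPartner-χ : ∀ n k H K → length H ≤ k → k ≤ n →
  (k ≡ length H → K ≐ H) → (length H < k → K ≐ (H ∪ range (n ∸ k + length H + 1) n)) →
  ∀ x → χ K x ≡ (χ H x ∨ elem x (range (n ∸ k + length H + 1) n))
kPartner-χ n k H K |H|≤k k≤n same longer x with m≤n⇒m<n∨m≡n |H|≤k
... | inj₁ |H|<k = trans (longer |H|<k x) (elem-++ H _ x)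
... | inj₂ |H|≡k rewrite range-above-empty n (n ∸ k + length H + 1) x
      (trans (cong (λ z → n ∸ k + z + 1) |H|≡k) (trans (cong (_+ 1) (m∸n+n≡m k≤n)) (+-comm n 1))) =
  trans (same (sym |H|≡k) x) (sym (∨-identityʳ (χ H x)))

record PartnerNoTop (m q′ s : ℕ) (H : List ℕ) : Set where
  field
    block₁ : ConstOn (χ H) 1 m true
    block₂ : ConstOn (χ H) (suc m) q′ false
    J∈H    : ConstOn (χ H) (suc m + q′) 1 true
    above  : ConstOn (χ H) (suc m + q′ + 1) s false

partnerNoTop : ∀ m q′ s X H → TwoBlocks (m + suc q′ + (s + 0)) m (m + suc q′) s X → IsPartner X H →
               PartnerNoTop m q′ s H
partnerNoTop m q′ s X H blocks partner = record
  { block₁ = partnerAt-outF X H J at 1 m (twoBlocks-block₁ m (suc q′) s 0 X blocks) ≤-refl (s≤s (m≤m+n m (suc q′)))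
  ; block₂ = partnerAt-inF X H J at (suc m) q′
               (constOn-≤ {χ X} {suc m} (n≤1+n q′) (twoBlocks-block₂ m (suc q′) s 0 X blocks)) (≤-reflexive (sym J≡))
  ; J∈H    = λ { zero _ → subst (λ x → χ H x ≡ true) (trans J≡ (sym (+-identityʳ (suc m + q′))))
                                  (partnerAt-apex X H J at J∈X)
              ; (suc i) (s≤s ()) }
  ; above  = partnerAt-above X H J at (suc m + q′ + 1) s
               (≤-reflexive (cong suc (trans J≡ (sym (+-comm (m + q′) 1)))))
  }
  where
  J n : ℕ
  J = m + suc q′
  n = J + (s + 0)
  J≡ : J ≡ suc m + q′
  J≡ = +-suc m q′
  J∈X : χ X J ≡ true
  J∈X = subst (λ x → χ X x ≡ true) (sym J≡) (twoBlocks-block₂ m (suc q′) s 0 X blocks q′ (n<1+n q′))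
  X-max : ∀ y → χ X y ≡ true → y ≤ J
  X-max y y∈X with ∨-true⁻ (elem y (range (suc m) J)) (elem y (range (suc (J + s)) n)) (trans (sym (blocks y)) y∈X)
  ... | inj₁ y∈low  = proj₂ (elem-range⁻ (suc m) J y y∈low)
  ... | inj₂ y∈high = let (J+s<y , y≤n) = elem-range⁻ (suc (J + s)) n y y∈high in
                      ⊥-elim (<-irrefl refl (<-≤-trans J+s<y (subst (y ≤_) (cong (J +_) (+-identityʳ s)) y≤n)))
  at : PartnerAt X H J
  at = isPartner⇒PartnerAt X H J partner J∈X X-max

length-PartnerNoTop : ∀ m q′ s H → PartnerNoTop m q′ s H → H ∈ subsetsOf (m + suc q′ + (s + 0)) → length H ≡ m + 1
length-PartnerNoTop m q′ s H P H∈ =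
  begin
    length H
  ≡⟨ length-sublist-span 1 n H (subst (λ L → H ∈ sublists L) (range≡span 1 n) H∈) ⟩
    countTrue (χ H) 1 n
  ≡⟨ cong (countTrue (χ H) 1) (n≡ m q′ s) ⟩
    countTrue (χ H) 1 (m + (q′ + (1 + (s + 0))))
  ≡⟨ countTrue-trueBlock (χ H) 1 m _ block₁ ⟩
    m + countTrue (χ H) (suc m) (q′ + (1 + (s + 0)))
  ≡⟨ cong (m +_) (countTrue-falseBlock (χ H) (suc m) q′ _ block₂) ⟩
    m + countTrue (χ H) (suc m + q′) (1 + (s + 0))
  ≡⟨ cong (m +_) (countTrue-trueBlock (χ H) (suc m + q′) 1 (s + 0) J∈H) ⟩
    m + (1 + countTrue (χ H) (suc m + q′ + 1) (s + 0))
  ≡⟨ cong (λ z → m + (1 + z)) (countTrue-falseBlock (χ H) (suc m + q′ + 1) s 0 above) ⟩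
    m + 1
  ∎
  where
  open ≡-Reasoning
  open PartnerNoTop P
  n : ℕ
  n = m + suc q′ + (s + 0)
  n≡ : ∀ m q′ s → m + suc q′ + (s + 0) ≡ m + (q′ + (1 + (s + 0)))
  n≡ = solve-∀

-- r is the lexicographically last (m + c + 1)-set with the first m + q′ + 1
-- positions fixed, so the sets preceding it are counted by the first
-- position of [m + 1, m + q′ + 1] they contain.
countPreceding-gap-top : ∀ r m q′ s₂ c →
  ConstOn r 1 m true → ConstOn r (suc m) q′ false → ConstOn r (suc m + q′) 1 true →
  ConstOn r (suc m + q′ + 1) s₂ false → ConstOn r (suc m + q′ + 1 + s₂) c true →
  countPreceding r 1 (m + (q′ + (1 + (s₂ + c)))) (m + suc c) ≡ binomialSum (suc q′) (s₂ + c) c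
countPreceding-gap-top r m q′ s₂ c r₁ r₂ r₃ r₄ r₅ =
  begin
    countPreceding r 1 (m + (q′ + (1 + (s₂ + c)))) (m + suc c)
  ≡⟨ countPreceding-trueBlock r 1 m _ (suc c) r₁ ⟩
    countPreceding r (suc m) (q′ + (1 + (s₂ + c))) (suc c)
  ≡⟨ countPreceding-falseBlock r (suc m) q′ (1 + (s₂ + c)) c r₂ ⟩
    binomialSum q′ (suc (s₂ + c)) c + countPreceding r (suc m + q′) (1 + (s₂ + c)) (1 + c)
  ≡⟨ cong (binomialSum q′ (suc (s₂ + c)) c +_) (countPreceding-trueBlock r (suc m + q′) 1 (s₂ + c) c r₃) ⟩
    binomialSum q′ (suc (s₂ + c)) c + countPreceding r (suc m + q′ + 1) (s₂ + c) c
  ≡⟨ cong (binomialSum q′ (suc (s₂ + c)) c +_) (countPreceding-falseTrue r (suc m + q′ + 1) s₂ c r₄ r₅) ⟩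
    binomialSum q′ (suc (s₂ + c)) c + binomial (s₂ + c) c
  ≡⟨ trans (+-comm (binomialSum q′ (suc (s₂ + c)) c) _) (sym (binomialSum-suc q′ (s₂ + c) c)) ⟩
    binomialSum (suc q′) (s₂ + c) c
  ∎
  where open ≡-Reasoning

countPreceding-PartnerNoTop-∪top : ∀ m q′ c s₂ H → PartnerNoTop m q′ (s₂ + c) H →
  countPreceding (χ (H ∪ range (suc m + q′ + 1 + s₂) (m + suc q′ + ((s₂ + c) + 0)))) 1 (m + suc q′ + ((s₂ + c) + 0))
                 (m + suc c)
  ≡ binomialSum (suc q′) ((s₂ + c) + 0) c
countPreceding-PartnerNoTop-∪top m q′ c s₂ H P =
  begin
    countPreceding (χ K′) 1 n (m + suc c)
  ≡⟨ cong (λ z → countPreceding (χ K′) 1 z (m + suc c)) (n≡ m q′ s₂ c) ⟩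
    countPreceding (χ K′) 1 (m + (q′ + (1 + (s₂ + c)))) (m + suc c)
  ≡⟨ countPreceding-gap-top (χ K′) m q′ s₂ c K₁ K₂ K₃ K₄ K₅ ⟩
    binomialSum (suc q′) (s₂ + c) c
  ≡⟨ cong (λ u → binomialSum (suc q′) u c) (sym (+-identityʳ (s₂ + c))) ⟩
    binomialSum (suc q′) ((s₂ + c) + 0) c
  ∎
  where
  open ≡-Reasoning
  open PartnerNoTop P
  n a₄ : ℕ
  n = m + suc q′ + ((s₂ + c) + 0)
  a₄ = suc m + q′ + 1 + s₂
  n≡ : ∀ m q′ s₂ c → m + suc q′ + (s₂ + c + 0) ≡ m + (q′ + (1 + (s₂ + c)))
  n≡ = solve-∀
  K′ : List ℕ
  K′ = H ∪ range a₄ n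
  beforeTop : ∀ x → x < a₄ → χ K′ x ≡ χ H x
  beforeTop x x< = trans (elem-++ H (range a₄ n) x)
    (trans (cong (χ H x ∨_) (elem-range-out a₄ n x (inj₁ x<))) (∨-identityʳ (χ H x)))
  K₁ : ConstOn (χ K′) 1 m true
  K₁ i i<m = trans (elem-++ H (range a₄ n) (suc i)) (∨-trueˡ _ (block₁ i i<m))
  K₂ : ConstOn (χ K′) (suc m) q′ false
  K₂ i i<q′ = trans (beforeTop (suc m + i) (≤-trans (+-monoʳ-< (suc m) i<q′) (≤-trans (m≤m+n _ 1) (m≤m+n _ s₂))))
                    (block₂ i i<q′)
  K₃ : ConstOn (χ K′) (suc m + q′) 1 true
  K₃ i i<1 = trans (elem-++ H (range a₄ n) (suc m + q′ + i)) (∨-trueˡ _ (J∈H i i<1))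
  K₄ : ConstOn (χ K′) (suc m + q′ + 1) s₂ false
  K₄ i i<s₂ = trans (beforeTop (suc m + q′ + 1 + i) (+-monoʳ-< (suc m + q′ + 1) i<s₂))
                    (above i (≤-trans i<s₂ (m≤m+n s₂ c)))
  K₅ : ConstOn (χ K′) a₄ c true
  K₅ i i<c = trans (elem-++ H (range a₄ n) (a₄ + i))
    (∨-trueʳ _ (elem-range⁺ a₄ n _ (m≤m+n _ i)
                 (≤-pred (subst (a₄ + i <_) (end≡ m q′ s₂ c) (+-monoʳ-< a₄ i<c)))))
    where
    end≡ : ∀ m q′ s₂ c → suc m + q′ + 1 + s₂ + c ≡ suc (m + suc q′ + (s₂ + c + 0))
    end≡ = solve-∀

-- When n ∉ X the partner H = [1, m] ∪ {J} has at most k points, and the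
-- k-partner is H ∪ [n - c + 1, n].
length-Lex-kPartner-noTop : ∀ m q′ c s₂ X K → KPartnerCount m (suc q′) (s₂ + c) 0 c X K
length-Lex-kPartner-noTop m q′ c s₂ X K blocks (K∈ , H , H∈ , partner , sameSize , longer , _) =
  trans (length-Lex-≐ n k K (H ∪ range a₄ n) K∈ K≐H∪top)
        (countPreceding-PartnerNoTop-∪top m q′ c s₂ H P)
  where
  n k a₄ : ℕ
  n = m + suc q′ + ((s₂ + c) + 0)
  k = m + suc c
  a₄ = suc m + q′ + 1 + s₂
  P : PartnerNoTop m q′ (s₂ + c) H
  P = partnerNoTop m q′ (s₂ + c) X H blocks partner
  n≡k+ : ∀ m q′ s₂ c → m + suc q′ + (s₂ + c + 0) ≡ q′ + s₂ + (m + suc c)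
  n≡k+ = solve-∀
  |H| : length H ≡ m + 1
  |H| = length-PartnerNoTop m q′ (s₂ + c) H P H∈
  |H|≤k : length H ≤ k
  |H|≤k = subst (_≤ k) (sym |H|) (+-monoʳ-≤ m (s≤s z≤n))
  k≤n : k ≤ n
  k≤n = subst (k ≤_) (sym (n≡k+ m q′ s₂ c)) (m≤n+m k (q′ + s₂))
  start≡a₄ : n ∸ k + length H + 1 ≡ a₄
  start≡a₄ = trans (cong₂ (λ a b → a + b + 1)
                           (trans (cong (_∸ k) (n≡k+ m q′ s₂ c)) (m+n∸n≡m (q′ + s₂) k)) |H|)
                   (arith m q′ s₂)
    where
    arith : ∀ m q′ s₂ → q′ + s₂ + (m + 1) + 1 ≡ suc m + q′ + 1 + s₂
    arith = solve-∀
  K≐H∪top : ∀ x → χ K x ≡ χ (H ∪ range a₄ n) x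
  K≐H∪top x = trans (kPartner-χ n k H K |H|≤k k≤n sameSize longer x)
                    (trans (cong (λ a → χ H x ∨ elem x (range a n)) start≡a₄) (sym (elem-++ H _ x)))

length-Lex-kPartner : ∀ m q s e c X K → 1 ≤ q → suc c ≤ s → KPartnerCount m q s e c X K
length-Lex-kPartner m q s (suc e′) c X K _ c<s =
  subst (λ s → KPartnerCount m q s (suc e′) c X K) (m+[n∸m]≡n c<s)
        (length-Lex-kPartner-withTop m q c (s ∸ suc c) e′ X K)
length-Lex-kPartner m (suc q′) s zero c X K _ c<s =
  subst (λ s → KPartnerCount m (suc q′) s 0 c X K) (m∸n+n≡m (≤-trans (n≤1+n c) c<s))
        (length-Lex-kPartner-noTop m q′ c (s ∸ c) X K)

∈binom⇒TwoBlocks : ∀ m q u e X → X ∈ binom (m + q + u) (q + e) → 1 ≤ q →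
  (X ∖ top (m + q + u) X) ≐ range (suc m) (m + q) →
  Σ ℕ λ s → u ≡ s + e × TwoBlocks (m + q + u) m (m + q) s X
∈binom⇒TwoBlocks m q u e X X∈ 1≤q X∖top≐ with ∖top≐range⇒TwoBlocks (m + q + u) m (m + q) X
       (∈binom⇒Bounded (m + q + u) (q + e) X X∈) (subst (_≤ m + q) (+-comm m 1) (+-monoʳ-≤ m 1≤q)) X∖top≐
... | s , J+s≤n , blocks = s , u≡s+e , blocks
  where
  s≤u : s ≤ u
  s≤u = +-cancelˡ-≤ (m + q) s u J+s≤n
  u≡s+[u∸s] : u ≡ s + (u ∸ s)
  u≡s+[u∸s] = sym (m+[n∸m]≡n s≤u)
  |X| : length X ≡ q + (u ∸ s)
  |X| = length-TwoBlocks m q s (u ∸ s) X (subst (λ u → TwoBlocks (m + q + u) m (m + q) s X) u≡s+[u∸s] blocks)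
          (subst (λ u → X ∈ sublists (span 1 (m + q + u))) u≡s+[u∸s] (proj₁ (∈binom⁻ (m + q + u) (q + e) X X∈)))
  u≡s+e : u ≡ s + e
  u≡s+e = trans u≡s+[u∸s]
    (cong (s +_) (+-cancelˡ-≡ q _ _ (trans (sym |X|) (proj₂ (∈binom⁻ (m + q + u) (q + e) X X∈)))))

length-Lex-∖top≐range : ∀ m q′ u e X → X ∈ binom (m + suc q′ + u) (suc q′ + e) →
  (X ∖ top (m + suc q′ + u) X) ≐ range (suc m) (m + suc q′) →
  length (Lex (m + suc q′ + u) X (suc q′ + e)) ≡ binomialSum m (suc q′ + u) (q′ + e) + binomial u e
length-Lex-∖top≐range m q′ u e X X∈ X∖top≐ with ∈binom⇒TwoBlocks m (suc q′) u e X X∈ (s≤s z≤n) X∖top≐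
... | s , refl , blocks = length-Lex-TwoBlocks m (suc q′) s e X blocks q′ refl

length-Lex-kPartner-∖top≐range : ∀ m q u e c X K → 1 ≤ q → X ∈ binom (m + q + u) (q + e) →
  (X ∖ top (m + q + u) X) ≐ range (suc m) (m + q) → suc c + e ≤ u →
  IsKPartner (m + q + u) (m + suc c) X K → length (Lex (m + q + u) K (m + suc c)) ≡ binomialSum q u c
length-Lex-kPartner-∖top≐range m q u e c X K 1≤q X∈ X∖top≐ 1+c+e≤u
  with ∈binom⇒TwoBlocks m q u e X X∈ 1≤q X∖top≐
... | s , refl , blocks = length-Lex-kPartner m q s e c X K 1≤q (+-cancelʳ-≤ e (suc c) s 1+c+e≤u) blocks

sum-map-cong : ∀ (f g : ℕ → ℕ) is → (∀ i → i ∈ is → f i ≡ g i) → sumℕ (map f is) ≡ sumℕ (map g is)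
sum-map-cong f g []       h = refl
sum-map-cong f g (i ∷ is) h = cong₂ _+_ (h i (here refl)) (sum-map-cong f g is (λ j → h j ∘ there))

sum-map-+ : ∀ (f g : ℕ → ℕ) is → sumℕ (map (λ i → f i + g i) is) ≡ sumℕ (map f is) + sumℕ (map g is)
sum-map-+ f g []       = refl
sum-map-+ f g (i ∷ is) = trans (cong (f i + g i +_) (sum-map-+ f g is)) (interchange (f i) (g i) _ _)
  where
  interchange : ∀ a b c d → a + b + (c + d) ≡ a + c + (b + d)
  interchange = solve-∀

*-distribˡ-sum-map : ∀ k (f : ℕ → ℕ) is → k * sumℕ (map f is) ≡ sumℕ (map (λ i → k * f i) is)
*-distribˡ-sum-map k f []       = *-zeroʳ k
*-distribˡ-sum-map k f (i ∷ is) = trans (*-distribˡ-+ k (f i) _) (cong (k * f i +_) (*-distribˡ-sum-map k f is))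

sum-map-mono-≤ : ∀ (f g : ℕ → ℕ) is → (∀ i → i ∈ is → f i ≤ g i) → sumℕ (map f is) ≤ sumℕ (map g is)
sum-map-mono-≤ f g []       h = z≤n
sum-map-mono-≤ f g (i ∷ is) h = +-mono-≤ (h i (here refl)) (sum-map-mono-≤ f g is (λ j → h j ∘ there))

suc-*-binomial : ∀ u c d → c + d ≡ suc u → suc u * binomial u c ≡ d * binomial (suc u) c
suc-*-binomial u c d c+d≡1+u = trans (sym (suc-*-binomial-suc-suc u c)) (suc-*-binomial-suc (suc u) c d c+d≡1+u)

*-binomial-suc-≤ : ∀ u c P → P + c ≤ suc u → P * binomial (suc u) c ≤ suc u * binomial u c
*-binomial-suc-≤ u c P P+c≤1+u =
  begin
    P * binomial (suc u) c
  ≤⟨ *-monoˡ-≤ (binomial (suc u) c) (m+n≤o⇒m≤o∸n P P+c≤1+u) ⟩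
    (suc u ∸ c) * binomial (suc u) c
  ≡⟨ suc-*-binomial u c (suc u ∸ c) (m+[n∸m]≡n (m+n≤o⇒n≤o P P+c≤1+u)) ⟨
    suc u * binomial u c
  ∎
  where open ≤-Reasoning

-- Multiplying by L + 2 turns the sums over u into sums over u + 1, via
-- (u + 1) C(u, c) = (u + 1 - c) C(u + 1, c).
sum-binomial-suc-< : ∀ u L l is (c : ℕ → ℕ) → l < L → suc l ≤ u →
  (∀ i → i ∈ is → suc (suc L) + c i ≤ suc u) →
  sumℕ (map (λ i → binomial u (c i)) is) ≤ binomial u (suc L) + binomial u (suc l) →
  sumℕ (map (λ i → binomial (suc u) (c i)) is) < binomial (suc u) (suc (suc L)) + binomial (suc u) (suc (suc l))
sum-binomial-suc-< u L l is c l<L l<u c-small sum≤ = *-cancelˡ-< P _ _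
  (begin-strict
    P * sumℕ (map (λ i → binomial (suc u) (c i)) is)
  ≡⟨ *-distribˡ-sum-map P _ is ⟩
    sumℕ (map (λ i → P * binomial (suc u) (c i)) is)
  ≤⟨ sum-map-mono-≤ _ _ is (λ i m → *-binomial-suc-≤ u (c i) P (c-small i m)) ⟩
    sumℕ (map (λ i → suc u * binomial u (c i)) is)
  ≡⟨ *-distribˡ-sum-map (suc u) _ is ⟨
    suc u * sumℕ (map (λ i → binomial u (c i)) is)
  ≤⟨ *-monoʳ-≤ (suc u) sum≤ ⟩
    suc u * (binomial u (suc L) + binomial u (suc l))
  ≡⟨ *-distribˡ-+ (suc u) (binomial u (suc L)) _ ⟩
    suc u * binomial u (suc L) + suc u * binomial u (suc l)
  ≡⟨ cong₂ _+_ (suc-*-binomial-suc-suc u (suc L)) (suc-*-binomial-suc-suc u (suc l)) ⟨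
    P * binomial (suc u) P + suc (suc l) * B
  <⟨ +-monoʳ-< (P * binomial (suc u) P) (*-monoˡ-< B {{>-nonZero B-pos}} (s≤s (s≤s l<L))) ⟩
    P * binomial (suc u) P + P * B
  ≡⟨ *-distribˡ-+ P (binomial (suc u) P) B ⟨
    P * (binomial (suc u) P + B)
  ∎)
  where
  open ≤-Reasoning
  P : ℕ
  P = suc (suc L)
  B : ℕ
  B = binomial (suc u) (suc (suc l))
  B-pos : 0 < B
  B-pos = binomial-pos (suc u) (suc (suc l)) (s≤s l<u)

cancel-common-≤ : ∀ A₁ A₂ a b a′ b′ S R →
  A₁ + a + (A₂ + b) + (S + R) ≤ A₁ + (a + a′) + (A₂ + (b + b′)) + R → S ≤ a′ + b′
cancel-common-≤ A₁ A₂ a b a′ b′ S R ≤ =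
  +-cancelˡ-≤ (A₁ + a + (A₂ + b) + R) S (a′ + b′)
    (subst₂ _≤_ (lhs≡ A₁ A₂ a b S R) (rhs≡ A₁ A₂ a b a′ b′ R) ≤)
  where
  lhs≡ : ∀ A₁ A₂ a b S R → A₁ + a + (A₂ + b) + (S + R) ≡ A₁ + a + (A₂ + b) + R + S
  lhs≡ = solve-∀
  rhs≡ : ∀ A₁ A₂ a b a′ b′ R →
         A₁ + (a + a′) + (A₂ + (b + b′)) + R ≡ A₁ + a + (A₂ + b) + R + (a′ + b′)
  rhs≡ = solve-∀

add-common-< : ∀ A₁ A₂ a b a′ b′ S R → S < a′ + b′ →
  A₁ + a + (A₂ + b) + (S + R) < A₁ + (a + a′) + (A₂ + (b + b′)) + R
add-common-< A₁ A₂ a b a′ b′ S R < =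
  subst₂ _<_ (sym (lhs≡ A₁ A₂ a b S R)) (sym (rhs≡ A₁ A₂ a b a′ b′ R)) (+-monoʳ-< (A₁ + a + (A₂ + b) + R) <)
  where
  lhs≡ : ∀ A₁ A₂ a b S R → A₁ + a + (A₂ + b) + (S + R) ≡ A₁ + a + (A₂ + b) + R + S
  lhs≡ = solve-∀
  rhs≡ : ∀ A₁ A₂ a b a′ b′ R →
         A₁ + (a + a′) + (A₂ + (b + b′)) + R ≡ A₁ + a + (A₂ + b) + R + (a′ + b′)
  rhs≡ = solve-∀

sum-binomialSum-suc : ∀ q u (c : ℕ → ℕ) is →
  sumℕ (map (λ i → binomialSum (suc q) u (c i)) is)
  ≡ sumℕ (map (λ i → binomial u (c i)) is) + sumℕ (map (λ i → binomialSum q (suc u) (c i)) is)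
sum-binomialSum-suc q u c is =
  trans (sum-map-cong _ _ is (λ i _ → binomialSum-suc q u (c i))) (sum-map-+ _ _ is)

module GValue (n t m : ℕ) (k : ℕ → ℕ) (kₜ≡1+m : k t ≡ suc m) (k₂<k₁ : k 2 < k 1) (k₁+k₃≤n : k 1 + k 3 ≤ n)
              (3≤t : 3 ≤ t) (between : ∀ i → i ∈ range 3 t → k t ≤ k i × k i ≤ k 3) where

  c : ℕ → ℕ
  c i = k i ∸ suc m

  -- g(G₂) for G₂ ∖ G₂^t = [m + 1, m + q], n = m + q + u, k₂ = q + l and k₁ = q + L.
  gFormula : ℕ → ℕ → ℕ → ℕ → ℕ
  gFormula q u l L =
    binomialSum m (n ∸ m) (k 1 ∸ 1) + binomial u L + (binomialSum m (n ∸ m) (k 2 ∸ 1) + binomial u l)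
    + sumℕ (map (λ i → binomialSum q u (c i)) (range 3 t))

  gval≡gFormula : ∀ q′ u l L X₁ X₂ T → n ≡ m + suc q′ + u → k 2 ≡ suc q′ + l → k 1 ≡ suc q′ + L →
    (∀ i → i ∈ range 3 t → k i ≡ m + suc (c i) × suc (c i) + l ≤ u) →
    X₂ ∈ binom n (k 2) → (X₂ ∖ top n X₂) ≐ range (suc m) (m + suc q′) →
    IsParityOf n (k 1) X₂ X₁ → (∀ i → 3 ≤ i → i ≤ t → IsKPartner n (k i) X₂ (T i)) →
    gval n k t X₁ X₂ T ≡ gFormula (suc q′) u l L
  gval≡gFormula q′ u l L X₁ X₂ T refl k₂≡ k₁≡ partnerSizes X₂∈ X₂∖top≐
                (X₁∈ , X₂∖top≐X₁∖top , _) partners =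
    cong₂ _+_ (cong₂ _+_ lex₁ lex₂) lexPartners
    where
    n∸m≡ : n ∸ m ≡ suc q′ + u
    n∸m≡ = trans (cong (_∸ m) (+-assoc m (suc q′) u)) (m+n∸m≡n m _)
    X₂∈′ : X₂ ∈ binom n (suc q′ + l)
    X₂∈′ = subst (λ z → X₂ ∈ binom n z) k₂≡ X₂∈
    lex₁ : length (Lex n X₁ (k 1)) ≡ binomialSum m (n ∸ m) (k 1 ∸ 1) + binomial u L
    lex₁ = trans (cong (λ z → length (Lex n X₁ z)) k₁≡)
           (trans (length-Lex-∖top≐range m q′ u L X₁ (subst (λ z → X₁ ∈ binom n z) k₁≡ X₁∈)
                    (λ x → trans (sym (X₂∖top≐X₁∖top x)) (X₂∖top≐ x)))
                  (cong₂ (λ a b → binomialSum m a b + binomial u L) (sym n∸m≡) (cong (_∸ 1) (sym k₁≡))))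
    lex₂ : length (Lex n X₂ (k 2)) ≡ binomialSum m (n ∸ m) (k 2 ∸ 1) + binomial u l
    lex₂ = trans (cong (λ z → length (Lex n X₂ z)) k₂≡)
           (trans (length-Lex-∖top≐range m q′ u l X₂ X₂∈′ X₂∖top≐)
                  (cong₂ (λ a b → binomialSum m a b + binomial u l) (sym n∸m≡) (cong (_∸ 1) (sym k₂≡))))
    lexPartners : sumℕ (map (λ i → length (Lex n (T i) (k i))) (range 3 t))
                  ≡ sumℕ (map (λ i → binomialSum (suc q′) u (c i)) (range 3 t))
    lexPartners = sum-map-cong _ _ (range 3 t) λ i i∈ →
      let (kᵢ≡ , small) = partnerSizes i i∈
          (3≤i , i≤t)   = elem-range⁻ 3 t i (∈⇒elem i∈)
      in trans (cong (λ z → length (Lex n (T i) z)) kᵢ≡)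
               (length-Lex-kPartner-∖top≐range m (suc q′) u l (c i) X₂ (T i) (s≤s z≤n) X₂∈′ X₂∖top≐ small
                 (subst (λ z → IsKPartner n z X₂ (T i)) kᵢ≡ (partners i 3≤i i≤t)))

  gFormula-step : ∀ q u l L → l < L → suc l ≤ u → (∀ i → i ∈ range 3 t → suc (suc L) + c i ≤ suc u) →
    gFormula (suc q) (suc u) (suc l) (suc L) ≥ gFormula (suc (suc q)) u l L →
    gFormula q (suc (suc u)) (suc (suc l)) (suc (suc L)) > gFormula (suc q) (suc u) (suc l) (suc L)
  gFormula-step q u l L l<L l<u c-small G≥F =
    subst (_< gFormula q (suc (suc u)) (suc (suc l)) (suc (suc L)))
          (cong (G₀ +_) (sym (sum-binomialSum-suc q (suc u) c is)))
          (add-common-< A₁ A₂ _ _ _ _ _ _ (sum-binomial-suc-< u L l is c l<L l<u c-small S₁≤))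
    where
    is : List ℕ
    is = range 3 t
    A₁ A₂ F₀ G₀ : ℕ
    A₁ = binomialSum m (n ∸ m) (k 1 ∸ 1)
    A₂ = binomialSum m (n ∸ m) (k 2 ∸ 1)
    F₀ = A₁ + binomial u L + (A₂ + binomial u l)
    G₀ = A₁ + binomial (suc u) (suc L) + (A₂ + binomial (suc u) (suc l))
    S₁≤ : sumℕ (map (λ i → binomial u (c i)) is) ≤ binomial u (suc L) + binomial u (suc l)
    S₁≤ = cancel-common-≤ A₁ A₂ _ _ _ _ _ _
            (subst (_≤ gFormula (suc q) (suc u) (suc l) (suc L)) (cong (F₀ +_) (sum-binomialSum-suc (suc q) u c is)) G≥F)

  gAt : ℕ → ℕ
  gAt q = gFormula q (n ∸ (m + q)) (k 2 ∸ q) (k 1 ∸ q)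

  private
    kᵢ≡ : ∀ i → i ∈ range 3 t → k i ≡ m + suc (c i)
    kᵢ≡ i i∈ = trans (sym (m+[n∸m]≡n (subst (_≤ k i) kₜ≡1+m (proj₁ (between i i∈))))) (sym (+-suc m (c i)))

    k₁+kᵢ≤n : ∀ i → i ∈ range 3 t → k 1 + k i ≤ n
    k₁+kᵢ≤n i i∈ = ≤-trans (+-monoʳ-≤ (k 1) (proj₂ (between i i∈))) k₁+k₃≤n

    k₂+kᵢ<n : ∀ i → i ∈ range 3 t → k 2 + k i < n
    k₂+kᵢ<n i i∈ = <-≤-trans (+-monoˡ-< (k i) k₂<k₁) (k₁+kᵢ≤n i i∈)

    k₂+1+m≤n : k 2 + suc m ≤ n
    k₂+1+m≤n = <⇒≤ (subst (λ z → k 2 + z < n) kₜ≡1+m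
                      (k₂+kᵢ<n t (elem⇒∈ t (range 3 t) (elem-range⁺ 3 t t 3≤t ≤-refl))))

    m+k₂<n : m + k 2 < n
    m+k₂<n = subst (_≤ n) (trans (+-suc (k 2) m) (cong suc (+-comm (k 2) m))) k₂+1+m≤n

    cong₃ : ∀ (f : ℕ → ℕ → ℕ → ℕ) {x x′ y y′ z z′} →
            x ≡ x′ → y ≡ y′ → z ≡ z′ → f x y z ≡ f x′ y′ z′
    cong₃ f refl refl refl = refl

    ∸-step : ∀ {a b} → a < b → b ∸ a ≡ suc (b ∸ suc a)
    ∸-step {a} {suc b} (s≤s a≤b) = +-∸-assoc 1 a≤b

    n∸[m+q]-pred : ∀ q → m + suc q < n → n ∸ (m + q) ≡ suc (n ∸ (m + suc q))
    n∸[m+q]-pred q m+1+q<n = trans (∸-step (≤-<-trans (+-monoʳ-≤ m (n≤1+n q)) m+1+q<n))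
                                   (cong (λ z → suc (n ∸ z)) (sym (+-suc m q)))

  gval≡gAt : ∀ J q X₁ X₂ T → J ≡ m + q → 1 ≤ q → q ≤ k 2 →
    X₂ ∈ binom n (k 2) → (X₂ ∖ top n X₂) ≐ range (k t) J →
    IsParityOf n (k 1) X₂ X₁ → (∀ i → 3 ≤ i → i ≤ t → IsKPartner n (k i) X₂ (T i)) →
    gval n k t X₁ X₂ T ≡ gAt q
  gval≡gAt J (suc q′) X₁ X₂ T refl _ q≤k₂ X₂∈ X₂∖top≐ parity partners =
    gval≡gFormula q′ u l L X₁ X₂ T n≡ k₂≡ k₁≡ partnerSizes X₂∈
      (λ x → trans (X₂∖top≐ x) (cong (λ a → elem x (range a J)) kₜ≡1+m)) parity partners
    where
    q : ℕ
    q = suc q′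
    u : ℕ
    u = n ∸ (m + q)
    l : ℕ
    l = k 2 ∸ q
    L : ℕ
    L = k 1 ∸ q
    n≡ : n ≡ m + q + u
    n≡ = sym (m+[n∸m]≡n (<⇒≤ (≤-<-trans (+-monoʳ-≤ m q≤k₂) m+k₂<n)))
    k₂≡ : k 2 ≡ q + l
    k₂≡ = sym (m+[n∸m]≡n q≤k₂)
    k₁≡ : k 1 ≡ q + L
    k₁≡ = sym (m+[n∸m]≡n (≤-trans q≤k₂ (<⇒≤ k₂<k₁)))
    sizes≡ : ∀ i → i ∈ range 3 t → k 2 + k i ≡ m + q + (suc (c i) + l)
    sizes≡ i i∈ = trans (cong₂ _+_ k₂≡ (kᵢ≡ i i∈)) (rearrange m q (c i) l)
      where
      rearrange : ∀ m q c l → q + l + (m + suc c) ≡ m + q + (suc c + l)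
      rearrange = solve-∀
    partnerSizes : ∀ i → i ∈ range 3 t → k i ≡ m + suc (c i) × suc (c i) + l ≤ u
    partnerSizes i i∈ =
      kᵢ≡ i i∈ , +-cancelˡ-≤ (m + q) _ _ (subst₂ _≤_ (sizes≡ i i∈) n≡ (<⇒≤ (k₂+kᵢ<n i i∈)))

  gAt-step : ∀ q → suc (suc q) ≤ k 2 → gAt (suc q) ≥ gAt (suc (suc q)) → gAt q > gAt (suc q)
  gAt-step q q+2≤k₂ G≥F =
    subst₂ _<_ (sym shapeG) (sym shapeH) (gFormula-step q u l L l<L l<u c-small (subst (gAt Q ≤_) shapeG G≥F))
    where
    Q u l L : ℕ
    Q = suc (suc q)
    u = n ∸ (m + Q)
    l = k 2 ∸ Q
    L = k 1 ∸ Q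
    q+2≤k₁ : Q ≤ k 1
    q+2≤k₁ = ≤-trans q+2≤k₂ (<⇒≤ k₂<k₁)
    m+Q<n : m + Q < n
    m+Q<n = ≤-<-trans (+-monoʳ-≤ m q+2≤k₂) m+k₂<n
    uG : n ∸ (m + suc q) ≡ suc u
    uG = n∸[m+q]-pred (suc q) m+Q<n
    shapeG : gAt (suc q) ≡ gFormula (suc q) (suc u) (suc l) (suc L)
    shapeG = cong₃ (gFormula (suc q)) uG (∸-step q+2≤k₂) (∸-step q+2≤k₁)
    shapeH : gAt q ≡ gFormula q (suc (suc u)) (suc (suc l)) (suc (suc L))
    shapeH = cong₃ (gFormula q) (trans (n∸[m+q]-pred q (≤-<-trans (+-monoʳ-≤ m (n≤1+n (suc q))) m+Q<n)) (cong suc uG))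
                                (trans (∸-step (≤-trans (n≤1+n (suc q)) q+2≤k₂)) (cong suc (∸-step q+2≤k₂)))
                                (trans (∸-step (≤-trans (n≤1+n (suc q)) q+2≤k₁)) (cong suc (∸-step q+2≤k₁)))
    l<L : l < L
    l<L = ∸-monoˡ-< k₂<k₁ q+2≤k₂
    l<u : suc l ≤ u
    l<u = m+n≤o⇒m≤o∸n (suc l) (subst (_≤ n) (arith m Q l)
            (subst (λ z → z + suc m ≤ n) (sym (m+[n∸m]≡n q+2≤k₂)) k₂+1+m≤n))
      where
      arith : ∀ m Q l → Q + l + suc m ≡ suc l + (m + Q)
      arith = solve-∀
    c-small : ∀ i → i ∈ range 3 t → suc (suc L) + c i ≤ suc u
    c-small i i∈ = s≤s (m+n≤o⇒m≤o∸n (suc L + c i) (subst (_≤ n) sizes≡ (k₁+kᵢ≤n i i∈)))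
      where
      arith : ∀ m Q L c → Q + L + (m + suc c) ≡ suc L + c + (m + Q)
      arith = solve-∀
      sizes≡ : k 1 + k i ≡ suc L + c i + (m + Q)
      sizes≡ = trans (cong₂ _+_ (sym (m+[n∸m]≡n q+2≤k₁)) (kᵢ≡ i i∈)) (arith m Q L (c i))

antitone-between : ∀ (k : ℕ → ℕ) t → (∀ i → 2 ≤ i → i < t → k (suc i) ≤ k i) →
                   ∀ {i} j → 2 ≤ i → i ≤ j → j ≤ t → k j ≤ k i
antitone-between k t antitone j 2≤i i≤j j≤t with m≤n⇒m<n∨m≡n i≤j
... | inj₂ refl = ≤-refl
antitone-between k t antitone (suc j) 2≤i _ j<t | inj₁ (s≤s i≤j) =
  ≤-trans (antitone j (≤-trans 2≤i i≤j) j<t) (antitone-between k t antitone j 2≤i i≤j (<⇒≤ j<t))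

antitone-range : ∀ (k : ℕ → ℕ) t → (∀ i → 2 ≤ i → i < t → k (suc i) ≤ k i) →
                 ∀ i → i ∈ range 3 t → k t ≤ k i × k i ≤ k 3
antitone-range k t antitone i i∈ =
  let (3≤i , i≤t) = elem-range⁻ 3 t i (∈⇒elem i∈) in
  antitone-between k t antitone t (≤-trans (n≤1+n 2) 3≤i) i≤t ≤-refl ,
  antitone-between k t antitone i (n≤1+n 2) 3≤i i≤t

-- Writing k_t = m + 1, the sets [k_t, j - 2], [k_t, j - 1], [k_t, j] are
-- [m + 1, m + q], [m + 1, m + q + 1], [m + 1, m + q + 2].
decompose-j : ∀ kₜ j k₂ → 2 ≤ kₜ → kₜ + 2 ≤ j → j ≤ kₜ + k₂ ∸ 1 →
  Σ ℕ λ m → Σ ℕ λ q → kₜ ≡ suc m × j ≡ suc (suc (m + q)) × 1 ≤ q × suc (suc q) ≤ k₂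
decompose-j (suc m) j k₂ _ kₜ+2≤j j≤m+k₂ = m , q , refl , sym j≡ , m<n⇒0<n∸m 2+m<j , q+2≤k₂
  where
  2+m<j : suc (suc m) < j
  2+m<j = subst (_≤ j) (+-comm (suc m) 2) kₜ+2≤j
  q : ℕ
  q = j ∸ suc (suc m)
  j≡ : suc (suc (m + q)) ≡ j
  j≡ = m+[n∸m]≡n (<⇒≤ 2+m<j)
  q+2≤k₂ : suc (suc q) ≤ k₂
  q+2≤k₂ = +-cancelˡ-≤ m _ _
    (subst (_≤ m + k₂) (trans (sym j≡) (sym (trans (+-suc m (suc q)) (cong suc (+-suc m q))))) j≤m+k₂)

lemma3p14 : (n t : ℕ) (k : ℕ → ℕ) →
    3 ≤ t → k 2 < k 1 → (∀ i → 2 ≤ i → i < t → k (suc i) ≤ k i) → 2 ≤ k t →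
    k 1 + k 3 ≤ n → n < k 1 + k 2 →
    (j : ℕ) → k t + 2 ≤ j → j ≤ k t + k 2 ∸ 1 →
    (F₂ G₂ H₂ : List ℕ) →
    InF23 n k t F₂ → InF23 n k t G₂ → InF23 n k t H₂ →
    (F₂ ∖ top n F₂) ≐ range (k t) j →
    (G₂ ∖ top n G₂) ≐ range (k t) (j ∸ 1) →
    (H₂ ∖ top n H₂) ≐ range (k t) (j ∸ 2) →
    (F₁ G₁ H₁ : List ℕ) →
    IsParityOf n (k 1) F₂ F₁ → IsParityOf n (k 1) G₂ G₁ → IsParityOf n (k 1) H₂ H₁ →
    (TF TG TH : ℕ → List ℕ) →
    (∀ i → 3 ≤ i → i ≤ t → IsKPartner n (k i) F₂ (TF i)) →
    (∀ i → 3 ≤ i → i ≤ t → IsKPartner n (k i) G₂ (TG i)) →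
    (∀ i → 3 ≤ i → i ≤ t → IsKPartner n (k i) H₂ (TH i)) →
    gval n k t G₁ G₂ TG ≥ gval n k t F₁ F₂ TF →
    gval n k t H₁ H₂ TH > gval n k t G₁ G₂ TG
lemma3p14 n t k 3≤t k₂<k₁ antitone 2≤kₜ k₁+k₃≤n _ j kₜ+2≤j j≤kₜ+k₂∸1 F₂ G₂ H₂
  ((F₂∈ , _) , _) ((G₂∈ , _) , _) ((H₂∈ , _) , _) F-shape G-shape H-shape F₁ G₁ H₁ F-parity G-parity H-parity
  TF TG TH F-partners G-partners H-partners G≥F
  with decompose-j (k t) j (k 2) 2≤kₜ kₜ+2≤j j≤kₜ+k₂∸1
... | m , q , kₜ≡1+m , refl , 1≤q , q+2≤k₂ =
  subst₂ _<_ (sym gG) (sym gH) (gAt-step q q+2≤k₂ (subst₂ _≤_ gF gG G≥F))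
  where
  open GValue n t m k kₜ≡1+m k₂<k₁ k₁+k₃≤n 3≤t (antitone-range k t antitone)
  q+1≤k₂ : suc q ≤ k 2
  q+1≤k₂ = ≤-trans (n≤1+n (suc q)) q+2≤k₂
  gF : gval n k t F₁ F₂ TF ≡ gAt (suc (suc q))
  gF = gval≡gAt _ (suc (suc q)) F₁ F₂ TF (sym (trans (+-suc m (suc q)) (cong suc (+-suc m q))))
         (s≤s z≤n) q+2≤k₂ F₂∈ F-shape F-parity F-partners
  gG : gval n k t G₁ G₂ TG ≡ gAt (suc q)
  gG = gval≡gAt _ (suc q) G₁ G₂ TG (sym (+-suc m q)) (s≤s z≤n) q+1≤k₂ G₂∈ G-shape G-parity G-partners
  gH : gval n k t H₁ H₂ TH ≡ gAt q
  gH = gval≡gAt _ q H₁ H₂ TH refl 1≤q (≤-trans (n≤1+n q) q+1≤k₂) H₂∈ H-shape H-parity H-partners
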